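{- Let $G$ be an undirected connected loopless multigraph on vertex set $\{0,\dots,n\}$, $n\ge1$. The facets of the polytope $H_{Del_G}(O)$ are exactly the convex hulls of the sets $F_{i,j}$ for $0\le i,j\le n$, $i\ne j$.
   Context: $b_0,\dots,b_n\in\mathbb{R}^{n+1}$ are the rows of the Laplacian $Q(G)=D(G)-A(G)$ (degree matrix minus adjacency matrix with multiplicities). For a permutation $\sigma$ of $\{0,\dots,n\}$ put $u^\sigma_i=\sum_{j=0}^ib_{\sigma(j)}$ ($0\le i\le n$), let $\triangle_\sigma$ be the convex hull of $u^\sigma_0,\dots,u^\sigma_n$, and $H_{Del_G}(O)=\bigcup_\sigma\triangle_\sigma$; it is a convex polytope whose vertices are the points $u_S=\sum_{i\in S}b_i$ for nonempty proper subsets $S\subset\{0,\dots,n\}$. For $i\ne j$, $F_{i,j}$ is the set of vertices $u_S$ with $i\in S$ and $j\notin S$.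
   Formalization: The polytope $H_{Del_G}(O)$, its faces and the convex hulls of the $F_{i,j}$ lie in ℚ^(n+1) instead of $\mathbb{R}^{n+1}$, and the inequalities defining faces have rational coefficients. -}

module Defs where

open import Level using (0ℓ)
open import Data.Nat as ℕ using (ℕ; zero; suc; _≤ᵇ_)
open import Data.Integer using (+_)
open import Data.Rational using (ℚ; 0ℚ; 1ℚ; _+_; _*_; -_; _≤_; _/_)
open import Data.Fin using (Fin; toℕ)
open import Data.Fin.Subset using (Subset; _∈_; _∉_)
open import Data.Fin.Permutation using (Permutation′; _⟨$⟩ʳ_)
open import Data.Bool using (if_then_else_)
open import Data.Product using (Σ; _×_; ∃; ∃-syntax)
open import Relation.Binary.PropositionalEquality using (_≡_; _≢_)
open import Relation.Nullary using (¬_)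
open import Relation.Nullary.Decidable using (⌊_⌋)
open import Data.Fin using (_≟_)
open import Relation.Unary using (Pred; _⊆_)

ℕtoℚ : ℕ → ℚ
ℕtoℚ n = + n / 1

Σℚ : ∀ {k} → (Fin k → ℚ) → ℚ
Σℚ {zero}  f = 0ℚ
Σℚ {suc k} f = f Data.Fin.zero + Σℚ (λ i → f (Data.Fin.suc i))

Σℕ : ∀ {k} → (Fin k → ℕ) → ℕ
Σℕ {zero}  f = 0
Σℕ {suc k} f = f Data.Fin.zero ℕ.+ Σℕ (λ i → f (Data.Fin.suc i))

Pt : ℕ → Set
Pt d = Fin d → ℚ

ΣPt : ∀ {d k} → (Fin k → Pt d) → Pt d
ΣPt p c = Σℚ (λ i → p i c)

_·_ : ∀ {d} → Pt d → Pt d → ℚ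
x · y = Σℚ (λ c → x c * y c)

Conv : ∀ {d} → Pred (Pt d) 0ℓ → Pred (Pt d) 0ℓ
Conv X x = ∃[ k ] Σ (Fin k → Pt _) λ p → Σ (Fin k → ℚ) λ w →
  (∀ i → X (p i)) × (∀ i → 0ℚ ≤ w i) × (Σℚ w ≡ 1ℚ) ×
  (∀ c → x c ≡ Σℚ (λ i → w i * p i c))

AffIndep : ∀ {d k} → (Fin k → Pt d) → Set
AffIndep {d} {k} p = ∀ (μ : Fin k → ℚ) → Σℚ μ ≡ 0ℚ →
  (∀ c → Σℚ (λ i → μ i * p i c) ≡ 0ℚ) → ∀ i → μ i ≡ 0ℚ

HasAffIndep : ∀ {d} → Pred (Pt d) 0ℓ → ℕ → Set
HasAffIndep S m = Σ (Fin m → Pt _) λ p → (∀ i → S (p i)) × AffIndep p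

HasDim : ∀ {d} → Pred (Pt d) 0ℓ → ℕ → Set
HasDim S k = HasAffIndep S (suc k) × ¬ HasAffIndep S (suc (suc k))

IsFace : ∀ {d} → Pred (Pt d) 0ℓ → Pred (Pt d) 0ℓ → Set
IsFace {d} P F = Σ (Pt d) λ c → Σ ℚ λ δ →
  (∀ {x} → P x → c · x ≤ δ) ×
  (∀ {x} → F x → P x × c · x ≡ δ) ×
  (∀ {x} → P x → c · x ≡ δ → F x)

IsFacet : ∀ {d} → Pred (Pt d) 0ℓ → Pred (Pt d) 0ℓ → Set
IsFacet P F = IsFace P F × ∃[ k ] (HasDim P (suc k) × HasDim F k)

_≐_ : ∀ {d} → Pred (Pt d) 0ℓ → Pred (Pt d) 0ℓ → Set
X ≐ Y = (X ⊆ Y) × (Y ⊆ X)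

-- multigraphs on {0..n}, given by adjacency multiplicities
Adj : ℕ → Set
Adj n = Fin (suc n) → Fin (suc n) → ℕ

Symmetric : ∀ {n} → Adj n → Set
Symmetric A = ∀ i j → A i j ≡ A j i

Loopless : ∀ {n} → Adj n → Set
Loopless A = ∀ i → A i i ≡ 0

data Reach {n} (A : Adj n) : Fin (suc n) → Fin (suc n) → Set where
  here : ∀ {i} → Reach A i i
  step : ∀ {i j k} → A i j ≢ 0 → Reach A j k → Reach A i k

Connected : ∀ {n} → Adj n → Set
Connected A = ∀ i j → Reach A i j

deg : ∀ {n} → Adj n → Fin (suc n) → ℕ
deg A i = Σℕ (λ j → A i j)

-- Laplacian Q(G) = D(G) − A(G); b i is its i-th row
b : ∀ {n} → Adj n → Fin (suc n) → Pt (suc n)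
b A i j = if ⌊ i ≟ j ⌋ then ℕtoℚ (deg A i) else - ℕtoℚ (A i j)

-- u^σ_i = Σ_{j ≤ i} b_{σ(j)}
uσ : ∀ {n} → Adj n → Permutation′ (suc n) → Fin (suc n) → Pt (suc n)
uσ A σ i = ΣPt (λ j → if toℕ j ≤ᵇ toℕ i then b A (σ ⟨$⟩ʳ j) else (λ _ → 0ℚ))

Simplex : ∀ {n} → Adj n → Permutation′ (suc n) → Pred (Pt (suc n)) 0ℓ
Simplex A σ = Conv (λ x → ∃[ i ] (∀ c → x c ≡ uσ A σ i c))

HDel : ∀ {n} → Adj n → Pred (Pt (suc n)) 0ℓ
HDel A x = ∃[ σ ] Simplex A σ x

uS : ∀ {n} → Adj n → Subset (suc n) → Pt (suc n)
uS A S = ΣPt (λ i → if ⌊ Data.Fin.Subset.Properties._∈?_ i S ⌋ then b A i else (λ _ → 0ℚ))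
  where import Data.Fin.Subset.Properties

Fij : ∀ {n} → Adj n → Fin (suc n) → Fin (suc n) → Pred (Pt (suc n)) 0ℓ
Fij A i j x = ∃[ S ] (i ∈ S × j ∉ S × (∀ c → x c ≡ uS A S c))

-- Write Σb y = Σ_k y_k b_k. Every point of H_Del(O) is Σb y with 0 ≤ y ≤ 1 and max y = 1, and
-- conversely (sort y and telescope along the simplex of the sorting permutation); Σb is injective
-- up to constants because G is connected, so H_Del(O) has dimension n. A linear functional v
-- takes the value Σ_{k∈S} d_k at u_S, where d_k = v · b_k sums to zero. Hence the face cut out by
-- v consists of the u_S with S ⊇ {d > 0} and S ∩ {d < 0} = ∅; for a facet this leaves exactly n - 1
-- free coordinates, i.e. d is supported on two indices i, j and the face is conv F_{i,j}.
-- Conversely d = e_i - e_j is realised by some v, since Σb maps onto the vectors of sum zero.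

module Submission where

open import Level using (0ℓ)
open import Data.Nat as ℕ using (ℕ; zero; suc; _≤ᵇ_)
import Data.Nat.Properties as ℕP
open import Data.Integer as ℤ using () renaming (+_ to ℤ+)
import Data.Integer.Properties as ℤP
open import Data.Fin as Fin using (Fin; zero; suc; punchIn; punchOut; toℕ)
open import Data.Fin.Properties using (punchInᵢ≢i; punchIn-injective; punchIn-punchOut; punchOut-injective; any?)
open import Data.Fin.Subset using (Subset; _∈_; _∉_)
open import Data.Fin.Subset.Properties using (_∈?_)
open import Data.Fin.Permutation as Perm using (Permutation′; _⟨$⟩ʳ_; _⟨$⟩ˡ_; inverseˡ)
open import Data.Vec using (_∷_; lookup; tabulate)
open import Data.Vec.Properties using (lookup∘tabulate; []=⇒lookup; lookup⇒[]=)
open import Data.Vec.Functional using (insertAt)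
open import Data.Vec.Functional.Properties using (insertAt-lookup; insertAt-punchIn)
open import Data.Rational as ℚ using (ℚ; 0ℚ; 1ℚ; _+_; _*_; -_; _-_; _≤_; _<_; _⊔_; 1/_)
open import Data.Rational.Properties
import Data.Rational.Unnormalised as ℚᵘ
import Data.Rational.Unnormalised.Properties as ℚᵘP
open import Data.Rational.Solver using (module +-*-Solver)
import Algebra.Properties.CommutativeMonoid.Sum as CommutativeMonoidSum
open import Algebra.Properties.Group +-0-group using (⁻¹-involutive; x∙y⁻¹≈ε⇒x≈y)
open import Data.Bool using (Bool; true; false; if_then_else_; _∨_)
open import Data.Bool.Properties using (∨-zeroʳ)
open import Data.Unit using (⊤; tt)
open import Data.Product using (Σ; _×_; _,_; ∃; ∃-syntax; proj₁; proj₂)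
open import Data.Sum using (_⊎_; inj₁; inj₂; [_,_]′; map₁)
open import Data.Empty using (⊥; ⊥-elim)
open import Relation.Nullary using (¬_; Dec; yes; no; ¬?)
open import Relation.Nullary.Decidable using (⌊_⌋; toWitness; decidable-stable; isYes≗does; dec-true; dec-false)
open import Relation.Binary.PropositionalEquality using (_≡_; _≢_; refl; sym; trans; cong; cong₂; subst; subst₂; module ≡-Reasoning)
open import Relation.Unary using (Pred; _⊆_)
open import Relation.Binary.Definitions using (tri<; tri≈; tri>)
open import Function.Bundles using (_⇔_; mk⇔)
open import Defs

open +-*-Solver

𝟙 : Bool → ℚ
𝟙 true  = 1ℚ
𝟙 false = 0ℚ

𝟙-𝟙≤1 : ∀ a c → 𝟙 a - 𝟙 c ≤ 1ℚ
𝟙-𝟙≤1 true  true  = toWitness {a? = 1ℚ - 1ℚ ≤? 1ℚ} tt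
𝟙-𝟙≤1 true  false = toWitness {a? = 1ℚ - 0ℚ ≤? 1ℚ} tt
𝟙-𝟙≤1 false true  = toWitness {a? = 0ℚ - 1ℚ ≤? 1ℚ} tt
𝟙-𝟙≤1 false false = toWitness {a? = 0ℚ - 0ℚ ≤? 1ℚ} tt

𝟙-𝟙≡1 : ∀ a c → 𝟙 a - 𝟙 c ≡ 1ℚ → a ≡ true × c ≡ false
𝟙-𝟙≡1 true  false _ = refl , refl
𝟙-𝟙≡1 true  true  ()
𝟙-𝟙≡1 false true  ()
𝟙-𝟙≡1 false false ()

𝟙-nonNeg : ∀ β → 0ℚ ≤ 𝟙 β
𝟙-nonNeg true  = nonNegative⁻¹ 1ℚ
𝟙-nonNeg false = ≤-refl

𝟙≤1 : ∀ β → 𝟙 β ≤ 1ℚ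
𝟙≤1 true  = ≤-refl
𝟙≤1 false = nonNegative⁻¹ 1ℚ

𝟙*≤⊔0 : ∀ β x → 𝟙 β * x ≤ x ⊔ 0ℚ
𝟙*≤⊔0 true  x = subst (_≤ x ⊔ 0ℚ) (sym (*-identityˡ x)) (p≤p⊔q x 0ℚ)
𝟙*≤⊔0 false x = subst (_≤ x ⊔ 0ℚ) (sym (*-zeroˡ x)) (p≤q⊔p x 0ℚ)

𝟙⌊0<?⌋*≡⊔0 : ∀ x → 𝟙 ⌊ 0ℚ <? x ⌋ * x ≡ x ⊔ 0ℚ
𝟙⌊0<?⌋*≡⊔0 x = by-cases (0ℚ <? x)
  where
  by-cases : (0<?x : Dec (0ℚ < x)) → 𝟙 ⌊ 0<?x ⌋ * x ≡ x ⊔ 0ℚ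
  by-cases (yes 0<x) = trans (*-identityˡ x) (sym (p≥q⇒p⊔q≡p (<⇒≤ 0<x)))
  by-cases (no  0≮x) = trans (*-zeroˡ x) (sym (p≤q⇒p⊔q≡q (≮⇒≥ 0≮x)))

𝟙*≡⊔0⇒≡⌊0<?⌋ : ∀ β x → x ≢ 0ℚ → 𝟙 β * x ≡ x ⊔ 0ℚ → β ≡ ⌊ 0ℚ <? x ⌋
𝟙*≡⊔0⇒≡⌊0<?⌋ β x x≢0 eq = by-cases β (0ℚ <? x) eq
  where
  by-cases : ∀ β (0<?x : Dec (0ℚ < x)) → 𝟙 β * x ≡ x ⊔ 0ℚ → β ≡ ⌊ 0<?x ⌋
  by-cases true  (yes _)   _  = refl
  by-cases false (no _)    _  = refl
  by-cases false (yes 0<x) eq = ⊥-elim (x≢0 (sym (trans (sym (*-zeroˡ x)) (trans eq (p≥q⇒p⊔q≡p (<⇒≤ 0<x))))))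
  by-cases true  (no 0≮x)  eq = ⊥-elim (x≢0 (trans (sym (*-identityˡ x)) (trans eq (p≤q⇒p⊔q≡q (≮⇒≥ 0≮x)))))

ℕtoℚ-+ : ∀ a b → ℕtoℚ (a ℕ.+ b) ≡ ℕtoℚ a + ℕtoℚ b
ℕtoℚ-+ a b = toℚᵘ-injective (begin-equality
  ℚ.toℚᵘ (ℕtoℚ (a ℕ.+ b))             ≃⟨ toℚᵘ-fromℚᵘ (ℚᵘ.mkℚᵘ (ℤ+ (a ℕ.+ b)) 0) ⟩
  ℚᵘ.mkℚᵘ (ℤ+ (a ℕ.+ b)) 0            ≃⟨ ℚᵘ.*≡* (cong (ℤ._* ℤ+ 1) numerator) ⟩
  ℚᵘ.mkℚᵘ (ℤ+ a) 0 ℚᵘ.+ ℚᵘ.mkℚᵘ (ℤ+ b) 0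
    ≃⟨ ℚᵘP.+-cong (ℚᵘP.≃-sym (toℚᵘ-fromℚᵘ (ℚᵘ.mkℚᵘ (ℤ+ a) 0))) (ℚᵘP.≃-sym (toℚᵘ-fromℚᵘ (ℚᵘ.mkℚᵘ (ℤ+ b) 0))) ⟩
  ℚ.toℚᵘ (ℕtoℚ a) ℚᵘ.+ ℚ.toℚᵘ (ℕtoℚ b) ≃⟨ ℚᵘP.≃-sym (toℚᵘ-homo-+ (ℕtoℚ a) (ℕtoℚ b)) ⟩
  ℚ.toℚᵘ (ℕtoℚ a + ℕtoℚ b)            ∎)
  where
  open ℚᵘP.≤-Reasoning
  numerator : ℤ+ (a ℕ.+ b) ≡ ℚᵘ.↥ (ℚᵘ.mkℚᵘ (ℤ+ a) 0 ℚᵘ.+ ℚᵘ.mkℚᵘ (ℤ+ b) 0)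
  numerator = sym (cong₂ ℤ._+_ (ℤP.*-identityʳ (ℤ+ a)) (ℤP.*-identityʳ (ℤ+ b)))

ℕtoℚ-nonNeg : ∀ a → 0ℚ ≤ ℕtoℚ a
ℕtoℚ-nonNeg a = nonNegative⁻¹ _ {{normalize-nonNeg a 1}}

ℕtoℚ-≢0 : ∀ {a} → a ≢ 0 → ℕtoℚ a ≢ 0ℚ
ℕtoℚ-≢0 {zero}  a≢0 _ = a≢0 refl
ℕtoℚ-≢0 {suc a} _   e with fromℚᵘ-injective {ℚᵘ.mkℚᵘ (ℤ+ (suc a)) 0} {ℚᵘ.mkℚᵘ (ℤ+ 0) 0} e
... | ℚᵘ.*≡* ()

*-cancelˡ-≡0 : ∀ {a x} → a ≢ 0ℚ → a * x ≡ 0ℚ → x ≡ 0ℚ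
*-cancelˡ-≡0 {a} {x} a≢0 e = begin
  x                 ≡⟨ sym (*-identityˡ x) ⟩
  1ℚ * x            ≡⟨ cong (_* x) (sym (*-inverseˡ a)) ⟩
  a⁻¹ * a * x       ≡⟨ *-assoc a⁻¹ a x ⟩
  a⁻¹ * (a * x)     ≡⟨ cong (a⁻¹ *_) e ⟩
  a⁻¹ * 0ℚ          ≡⟨ *-zeroʳ a⁻¹ ⟩
  0ℚ                ∎
  where
  open ≡-Reasoning
  instance _ = ℚ.≢-nonZero a≢0
  a⁻¹ = 1/ a

0≤q-p : ∀ {p q} → p ≤ q → 0ℚ ≤ q - p
0≤q-p {p} {q} p≤q = subst (_≤ q - p) (+-inverseʳ p) (+-monoˡ-≤ (- p) p≤q)

nonNeg*nonNeg : ∀ {a b} → 0ℚ ≤ a → 0ℚ ≤ b → 0ℚ ≤ a * b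
nonNeg*nonNeg {a} {b} 0≤a 0≤b = subst (_≤ a * b) (*-zeroˡ b) (*-monoʳ-≤-nonNeg b {{ℚ.nonNegative 0≤b}} 0≤a)

argmax : ∀ {k} (f : Fin (suc k) → ℚ) → ∃[ i ] (∀ j → f j ≤ f i)
argmax {zero}  f = zero , λ { zero → ≤-refl }
argmax {suc k} f with argmax (λ j → f (suc j))
... | i , max with ≤-total (f zero) (f (suc i))
...   | inj₁ ≤i = suc i , λ { zero → ≤i ; (suc j) → max j }
...   | inj₂ ≥i = zero  , λ { zero → ≤-refl ; (suc j) → ≤-trans (max j) ≥i }

argmin : ∀ {k} (f : Fin (suc k) → ℚ) → ∃[ i ] (∀ j → f i ≤ f j)
argmin f with argmax (λ j → - f j)
... | i , max = i , λ j → neg-cancel-≤ (max j)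
  where
  neg-cancel-≤ : ∀ {p q} → - p ≤ - q → q ≤ p
  neg-cancel-≤ {p} {q} h = subst₂ _≤_ (⁻¹-involutive q) (⁻¹-involutive p) (neg-antimono-≤ h)

search : ∀ {k} (P : Fin k → Set) → (∀ i → Dec (P i)) → (∃[ i ] P i) ⊎ (∀ i → ¬ P i)
search P P? with any? P?
... | yes p  = inj₁ p
... | no  ¬p = inj₂ (λ i pi → ¬p (i , pi))

⌊⌋-true : ∀ {P : Set} (P? : Dec P) → P → ⌊ P? ⌋ ≡ true
⌊⌋-true P? p = trans (isYes≗does P?) (dec-true P? p)

⌊⌋-false : ∀ {P : Set} (P? : Dec P) → ¬ P → ⌊ P? ⌋ ≡ false
⌊⌋-false P? ¬p = trans (isYes≗does P?) (dec-false P? ¬p)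

-- Finite sums

Σℚ-cong : ∀ {k} {f g : Fin k → ℚ} → (∀ i → f i ≡ g i) → Σℚ f ≡ Σℚ g
Σℚ-cong {zero}  h = refl
Σℚ-cong {suc k} h = cong₂ _+_ (h zero) (Σℚ-cong (λ i → h (suc i)))

Σℚ-zero : ∀ {k} {f : Fin k → ℚ} → (∀ i → f i ≡ 0ℚ) → Σℚ f ≡ 0ℚ
Σℚ-zero {zero}  h = refl
Σℚ-zero {suc k} h = trans (cong₂ _+_ (h zero) (Σℚ-zero (λ i → h (suc i)))) (+-identityˡ 0ℚ)

Σℚ-+ : ∀ {k} (f g : Fin k → ℚ) → Σℚ (λ i → f i + g i) ≡ Σℚ f + Σℚ g
Σℚ-+ {zero}  f g = refl
Σℚ-+ {suc k} f g = trans (cong (f zero + g zero +_) (Σℚ-+ (λ i → f (suc i)) (λ i → g (suc i))))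
  (solve 4 (λ a b c d → (a :+ b) :+ (c :+ d) := (a :+ c) :+ (b :+ d)) refl (f zero) (g zero) _ _)

Σℚ-*ˡ : ∀ {k} (a : ℚ) (f : Fin k → ℚ) → Σℚ (λ i → a * f i) ≡ a * Σℚ f
Σℚ-*ˡ {zero}  a f = sym (*-zeroʳ a)
Σℚ-*ˡ {suc k} a f = trans (cong (a * f zero +_) (Σℚ-*ˡ a (λ i → f (suc i)))) (sym (*-distribˡ-+ a _ _))

Σℚ-*ʳ : ∀ {k} (a : ℚ) (f : Fin k → ℚ) → Σℚ (λ i → f i * a) ≡ Σℚ f * a
Σℚ-*ʳ a f = trans (Σℚ-cong (λ i → *-comm (f i) a)) (trans (Σℚ-*ˡ a f) (*-comm a _))

Σℚ-neg : ∀ {k} (f : Fin k → ℚ) → Σℚ (λ i → - f i) ≡ - Σℚ f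
Σℚ-neg f = trans (Σℚ-cong (λ i → solve 1 (λ x → :- x := (:- con 1ℚ) :* x) refl (f i)))
  (trans (Σℚ-*ˡ (- 1ℚ) f) (solve 1 (λ x → (:- con 1ℚ) :* x := :- x) refl (Σℚ f)))

Σℚ-- : ∀ {k} (f g : Fin k → ℚ) → Σℚ (λ i → f i - g i) ≡ Σℚ f - Σℚ g
Σℚ-- f g = trans (Σℚ-+ f (λ i → - g i)) (cong (Σℚ f +_) (Σℚ-neg g))

module ℚSum = CommutativeMonoidSum +-0-commutativeMonoid

Σℚ≡sum : ∀ {k} (f : Fin k → ℚ) → Σℚ f ≡ ℚSum.sum f
Σℚ≡sum {zero}  f = refl
Σℚ≡sum {suc k} f = cong (f zero +_) (Σℚ≡sum (λ i → f (suc i)))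

Σℚ-comm : ∀ {m k} (f : Fin m → Fin k → ℚ) → Σℚ (λ i → Σℚ (λ j → f i j)) ≡ Σℚ (λ j → Σℚ (λ i → f i j))
Σℚ-comm {m} {k} f = begin
  Σℚ (λ i → Σℚ (f i))                     ≡⟨ Σℚ-cong (λ i → Σℚ≡sum (f i)) ⟩
  Σℚ (λ i → ℚSum.sum (f i))               ≡⟨ Σℚ≡sum {m} _ ⟩
  ℚSum.sum (λ i → ℚSum.sum (f i))         ≡⟨ ℚSum.∑-comm f ⟩
  ℚSum.sum (λ j → ℚSum.sum (λ i → f i j)) ≡⟨ sym (Σℚ≡sum {k} _) ⟩
  Σℚ (λ j → ℚSum.sum (λ i → f i j))       ≡⟨ sym (Σℚ-cong (λ j → Σℚ≡sum (λ i → f i j))) ⟩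
  Σℚ (λ j → Σℚ (λ i → f i j))             ∎
  where open ≡-Reasoning

Σℚ-permute : ∀ {k} (f : Fin k → ℚ) (σ : Permutation′ k) → Σℚ f ≡ Σℚ (λ j → f (σ ⟨$⟩ʳ j))
Σℚ-permute {k} f σ = trans (Σℚ≡sum f) (trans (ℚSum.sum-permute f σ) (sym (Σℚ≡sum {k} _)))

Σℚ-remove : ∀ {k} (f : Fin (suc k) → ℚ) (l : Fin (suc k)) → Σℚ f ≡ f l + Σℚ (λ t → f (punchIn l t))
Σℚ-remove {k} f l = trans (Σℚ≡sum f) (trans (ℚSum.sum-remove {i = l} f) (cong (f l +_) (sym (Σℚ≡sum {k} _))))

Σℚ-single : ∀ {k} (f : Fin k → ℚ) (l : Fin k) → (∀ i → i ≢ l → f i ≡ 0ℚ) → Σℚ f ≡ f l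
Σℚ-single {suc k} f l h = trans (Σℚ-remove f l)
  (trans (cong (f l +_) (Σℚ-zero (λ t → h _ (punchInᵢ≢i l t)))) (+-identityʳ _))

Σℚ-const : ∀ k (a : ℚ) → Σℚ {k} (λ _ → a) ≡ ℕtoℚ k * a
Σℚ-const zero    a = sym (*-zeroˡ a)
Σℚ-const (suc k) a = begin
  a + Σℚ {k} (λ _ → a)        ≡⟨ cong (a +_) (Σℚ-const k a) ⟩
  a + ℕtoℚ k * a              ≡⟨ solve 2 (λ a x → a :+ x :* a := (con 1ℚ :+ x) :* a) refl a (ℕtoℚ k) ⟩
  (1ℚ + ℕtoℚ k) * a           ≡⟨ cong (_* a) (sym (ℕtoℚ-+ 1 k)) ⟩
  ℕtoℚ (suc k) * a            ∎
  where open ≡-Reasoning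

Σℚ-mono-≤ : ∀ {k} {f g : Fin k → ℚ} → (∀ i → f i ≤ g i) → Σℚ f ≤ Σℚ g
Σℚ-mono-≤ {zero}  h = ≤-refl
Σℚ-mono-≤ {suc k} h = +-mono-≤ (h zero) (Σℚ-mono-≤ (λ i → h (suc i)))

Σℚ-nonNeg : ∀ {k} {f : Fin k → ℚ} → (∀ i → 0ℚ ≤ f i) → 0ℚ ≤ Σℚ f
Σℚ-nonNeg {k} {f} h = subst (_≤ Σℚ f) (Σℚ-zero {k} {λ _ → 0ℚ} (λ _ → refl)) (Σℚ-mono-≤ h)

nonNeg+nonNeg≡0⇒≡0 : ∀ {a b} → 0ℚ ≤ a → 0ℚ ≤ b → a + b ≡ 0ℚ → a ≡ 0ℚ
nonNeg+nonNeg≡0⇒≡0 {a} {b} ha hb e =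
  ≤-antisym (subst (a ≤_) e (subst (_≤ a + b) (+-identityʳ a) (+-monoʳ-≤ a hb))) ha

Σℚ-nonNeg≡0⇒≡0 : ∀ {k} {f : Fin k → ℚ} → (∀ i → 0ℚ ≤ f i) → Σℚ f ≡ 0ℚ → ∀ i → f i ≡ 0ℚ
Σℚ-nonNeg≡0⇒≡0 {suc k} {f} h e zero    = nonNeg+nonNeg≡0⇒≡0 (h zero) (Σℚ-nonNeg (λ i → h (suc i))) e
Σℚ-nonNeg≡0⇒≡0 {suc k} {f} h e (suc i) = Σℚ-nonNeg≡0⇒≡0 (λ i → h (suc i))
  (nonNeg+nonNeg≡0⇒≡0 (Σℚ-nonNeg (λ i → h (suc i))) (h zero) (trans (+-comm _ (f zero)) e)) i

Σℚ≡0⇒max>0 : ∀ {k} {f : Fin k → ℚ} {i k₀} → Σℚ f ≡ 0ℚ → f k₀ ≢ 0ℚ → (∀ j → f j ≤ f i) → 0ℚ < f i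
Σℚ≡0⇒max>0 {f = f} {k₀ = k₀} Σf≡0 fk₀≢0 max = ≰⇒> λ fi≤0 →
  fk₀≢0 (neg-injective (Σℚ-nonNeg≡0⇒≡0 (λ j → neg-antimono-≤ (≤-trans (max j) fi≤0)) (trans (Σℚ-neg f) (cong -_ Σf≡0)) k₀))

Σℚ≡0⇒min<0 : ∀ {k} {f : Fin k → ℚ} {i k₀} → Σℚ f ≡ 0ℚ → f k₀ ≢ 0ℚ → (∀ j → f i ≤ f j) → f i < 0ℚ
Σℚ≡0⇒min<0 {k₀ = k₀} Σf≡0 fk₀≢0 min = ≰⇒> λ 0≤fi →
  fk₀≢0 (Σℚ-nonNeg≡0⇒≡0 (λ j → ≤-trans 0≤fi (min j)) Σf≡0 k₀)

ℕtoℚ-Σℕ : ∀ {k} (f : Fin k → ℕ) → ℕtoℚ (Σℕ f) ≡ Σℚ (λ i → ℕtoℚ (f i))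
ℕtoℚ-Σℕ {zero}  f = refl
ℕtoℚ-Σℕ {suc k} f = trans (ℕtoℚ-+ (f zero) _) (cong (ℕtoℚ (f zero) +_) (ℕtoℚ-Σℕ (λ i → f (suc i))))

average-const : ∀ {m} (w v : Fin m → ℚ) (δ : ℚ) → Σℚ w ≡ 1ℚ → (∀ l → v l ≡ δ) → Σℚ (λ l → w l * v l) ≡ δ
average-const w v δ Σw≡1 v≡δ =
  trans (Σℚ-cong (λ l → cong (w l *_) (v≡δ l))) (trans (Σℚ-*ʳ δ w) (trans (cong (_* δ) Σw≡1) (*-identityˡ δ)))

average-≤ : ∀ {m} (w v : Fin m → ℚ) (δ : ℚ) → (∀ l → 0ℚ ≤ w l) → Σℚ w ≡ 1ℚ → (∀ l → v l ≤ δ) →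
  Σℚ (λ l → w l * v l) ≤ δ
average-≤ w v δ w≥0 Σw≡1 v≤δ = subst (_ ≤_) (average-const w (λ _ → δ) δ Σw≡1 (λ _ → refl))
  (Σℚ-mono-≤ (λ l → *-monoˡ-≤-nonNeg (w l) {{ℚ.nonNegative (w≥0 l)}} (v≤δ l)))

δ : ∀ {N} → Fin N → Fin N → ℚ
δ k c = 𝟙 ⌊ k Fin.≟ c ⌋

δ-refl : ∀ {N} (k : Fin N) → δ k k ≡ 1ℚ
δ-refl k = cong 𝟙 (⌊⌋-true (k Fin.≟ k) refl)

δ-≢ : ∀ {N} {k c : Fin N} → k ≢ c → δ k c ≡ 0ℚ
δ-≢ {k = k} {c} k≢c = cong 𝟙 (⌊⌋-false (k Fin.≟ c) k≢c)

δ-*-swap : ∀ {N} (k c : Fin N) (f : Fin N → ℚ) → δ k c * f k ≡ δ c k * f c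
δ-*-swap k c f = by-cases (k Fin.≟ c)
  where
  by-cases : Dec (k ≡ c) → δ k c * f k ≡ δ c k * f c
  by-cases (yes refl) = refl
  by-cases (no k≢c)   = trans (cong (_* f k) (δ-≢ k≢c))
    (trans (*-zeroˡ (f k)) (sym (trans (cong (_* f c) (δ-≢ (λ c≡k → k≢c (sym c≡k)))) (*-zeroˡ (f c)))))

Σℚ-δ : ∀ {N} (k : Fin N) (f : Fin N → ℚ) → Σℚ (λ c → δ k c * f c) ≡ f k
Σℚ-δ k f = trans (Σℚ-single _ k off-diagonal) (trans (cong (_* f k) (δ-refl k)) (*-identityˡ (f k)))
  where
  off-diagonal : ∀ c → c ≢ k → δ k c * f c ≡ 0ℚ
  off-diagonal c c≢k = trans (cong (_* f c) (δ-≢ (λ k≡c → c≢k (sym k≡c)))) (*-zeroˡ (f c))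

-- Linear and affine dependence

NontrivialRelation : ∀ {m r} → (Fin m → Fin r → ℚ) → Set
NontrivialRelation {m} v = Σ (Fin m → ℚ) λ μ → (∃[ l ] μ l ≢ 0ℚ) × (∀ c → Σℚ (λ l → μ l * v l c) ≡ 0ℚ)

relation-zeroColumn : ∀ {m r} (v : Fin (suc m) → Fin (suc r) → ℚ) → (∀ l → v l zero ≡ 0ℚ) →
  NontrivialRelation (λ l c → v (suc l) (suc c)) → NontrivialRelation v
relation-zeroColumn v col₀ (μ , (l , μl≢0) , rel) = μ′ , (suc l , μl≢0) , rel′
  where
  μ′ : Fin _ → ℚ
  μ′ zero    = 0ℚ
  μ′ (suc l) = μ l
  drop-row₀ : ∀ c → Σℚ (λ l → μ′ l * v l c) ≡ Σℚ (λ l → μ l * v (suc l) c)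
  drop-row₀ c = trans (cong (_+ Σℚ (λ l → μ l * v (suc l) c)) (*-zeroˡ (v zero c))) (+-identityˡ _)
  rel′ : ∀ c → Σℚ (λ l → μ′ l * v l c) ≡ 0ℚ
  rel′ zero    = trans (drop-row₀ zero) (Σℚ-zero (λ l → trans (cong (μ l *_) (col₀ (suc l))) (*-zeroʳ (μ l))))
  rel′ (suc c) = trans (drop-row₀ (suc c)) (rel c)

eliminate : ∀ {m r} (v : Fin (suc m) → Fin (suc r) → ℚ) (l₀ : Fin (suc m)) → v l₀ zero ≢ 0ℚ → Fin m → Fin r → ℚ
eliminate v l₀ a≢0 t c = v (punchIn l₀ t) (suc c) - (v (punchIn l₀ t) zero * 1/ v l₀ zero) * v l₀ (suc c)
  where instance _ = ℚ.≢-nonZero a≢0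

relation-pivot : ∀ {m r} (v : Fin (suc m) → Fin (suc r) → ℚ) (l₀ : Fin (suc m)) (a≢0 : v l₀ zero ≢ 0ℚ) →
  NontrivialRelation (eliminate v l₀ a≢0) → NontrivialRelation v
relation-pivot v l₀ a≢0 (μ , (t₀ , μt₀≢0) , rel) = μ′ , (punchIn l₀ t₀ , μ′t₀≢0) , rel′
  where
  instance _ = ℚ.≢-nonZero a≢0
  κ : Fin _ → ℚ
  κ t = v (punchIn l₀ t) zero * 1/ v l₀ zero
  μ₀ = - Σℚ (λ t → μ t * κ t)
  μ′ = insertAt μ l₀ μ₀
  μ′t₀≢0 : μ′ (punchIn l₀ t₀) ≢ 0ℚ
  μ′t₀≢0 = subst (_≢ 0ℚ) (sym (insertAt-punchIn μ l₀ μ₀ t₀)) μt₀≢0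
  split : ∀ (g : Fin _ → ℚ) → Σℚ (λ l → μ′ l * g l) ≡ μ₀ * g l₀ + Σℚ (λ t → μ t * g (punchIn l₀ t))
  split g = trans (Σℚ-remove (λ l → μ′ l * g l) l₀)
    (cong₂ _+_ (cong (_* g l₀) (insertAt-lookup μ l₀ μ₀))
               (Σℚ-cong (λ t → cong (_* g (punchIn l₀ t)) (insertAt-punchIn μ l₀ μ₀ t))))
  column₀ : ∀ t → v (punchIn l₀ t) zero ≡ κ t * v l₀ zero
  column₀ t = sym (begin
    κ t * a                                  ≡⟨ *-assoc (v (punchIn l₀ t) zero) (1/ a) a ⟩
    v (punchIn l₀ t) zero * (1/ a * a)       ≡⟨ cong (v (punchIn l₀ t) zero *_) (*-inverseˡ a) ⟩
    v (punchIn l₀ t) zero * 1ℚ               ≡⟨ *-identityʳ _ ⟩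
    v (punchIn l₀ t) zero                    ∎)
    where
    open ≡-Reasoning
    a = v l₀ zero
  rel′ : ∀ c → Σℚ (λ l → μ′ l * v l c) ≡ 0ℚ
  rel′ zero = begin
    Σℚ (λ l → μ′ l * v l zero)                              ≡⟨ split (λ l → v l zero) ⟩
    μ₀ * a + Σℚ (λ t → μ t * v (punchIn l₀ t) zero)          ≡⟨ cong (μ₀ * a +_) (Σℚ-cong (λ t → cong (μ t *_) (column₀ t))) ⟩
    μ₀ * a + Σℚ (λ t → μ t * (κ t * a))                      ≡⟨ cong (μ₀ * a +_) (trans (Σℚ-cong (λ t → sym (*-assoc (μ t) (κ t) a))) (Σℚ-*ʳ a (λ t → μ t * κ t))) ⟩
    μ₀ * a + Σℚ (λ t → μ t * κ t) * a                        ≡⟨ solve 2 (λ s a → (:- s) :* a :+ s :* a := con 0ℚ) refl (Σℚ (λ t → μ t * κ t)) a ⟩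
    0ℚ                                                      ∎
    where
    open ≡-Reasoning
    a = v l₀ zero
  rel′ (suc c) = begin
    Σℚ (λ l → μ′ l * v l (suc c))                                            ≡⟨ split (λ l → v l (suc c)) ⟩
    μ₀ * a + Σℚ (λ t → μ t * v (punchIn l₀ t) (suc c))
      ≡⟨ cong (_+ Σℚ (λ t → μ t * v (punchIn l₀ t) (suc c)))
           (trans (cong (_* a) (sym (Σℚ-neg (λ t → μ t * κ t)))) (sym (Σℚ-*ʳ a (λ t → - (μ t * κ t))))) ⟩
    Σℚ (λ t → - (μ t * κ t) * a) + Σℚ (λ t → μ t * v (punchIn l₀ t) (suc c)) ≡⟨ sym (Σℚ-+ (λ t → - (μ t * κ t) * a) _) ⟩
    Σℚ (λ t → - (μ t * κ t) * a + μ t * v (punchIn l₀ t) (suc c))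
      ≡⟨ Σℚ-cong (λ t → solve 4 (λ m k a x → (:- (m :* k)) :* a :+ m :* x := m :* (x :- k :* a)) refl (μ t) (κ t) a _) ⟩
    Σℚ (λ t → μ t * (v (punchIn l₀ t) (suc c) - κ t * a))                    ≡⟨ rel c ⟩
    0ℚ                                                                      ∎
    where
    open ≡-Reasoning
    a = v l₀ (suc c)

rows-dependent : ∀ r (v : Fin (suc r) → Fin r → ℚ) → NontrivialRelation v
rows-dependent zero    v = (λ _ → 1ℚ) , (zero , λ ()) , λ ()
rows-dependent (suc r) v with search (λ l → v l zero ≢ 0ℚ) (λ l → ¬? (v l zero ≟ 0ℚ))
... | inj₁ (l₀ , a≢0) = relation-pivot v l₀ a≢0 (rows-dependent r (eliminate v l₀ a≢0))
... | inj₂ none       = relation-zeroColumn v (λ l → decidable-stable (v l zero ≟ 0ℚ) (none l))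
                                            (rows-dependent r (λ l c → v (suc l) (suc c)))

hasAffIndep-tail : ∀ {d m} {S : Pred (Pt d) 0ℓ} → HasAffIndep S (suc m) → HasAffIndep S m
hasAffIndep-tail (p , p∈S , indep) = (λ t → p (suc t)) , (λ t → p∈S (suc t)) , indep′
  where
  indep′ : AffIndep (λ t → p (suc t))
  indep′ μ Σμ≡0 rel t = indep (insertAt μ zero 0ℚ) (trans (+-identityˡ _) Σμ≡0)
    (λ c → trans (cong (_+ Σℚ (λ l → μ l * p (suc l) c)) (*-zeroˡ (p zero c))) (trans (+-identityˡ _) (rel c))) (suc t)

hasAffIndep-≤ : ∀ {d m m′} {S : Pred (Pt d) 0ℓ} → m ℕ.≤ m′ → HasAffIndep S m′ → HasAffIndep S m
hasAffIndep-≤ {S = S} m≤m′ h with ℕP.m≤n⇒m<n∨m≡n m≤m′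
... | inj₂ refl       = h
... | inj₁ (ℕ.s≤s m≤) = hasAffIndep-≤ {S = S} m≤ (hasAffIndep-tail {S = S} h)

hasAffIndep-⊆ : ∀ {d m} {X Y : Pred (Pt d) 0ℓ} → X ⊆ Y → HasAffIndep X m → HasAffIndep Y m
hasAffIndep-⊆ X⊆Y (p , p∈X , indep) = p , (λ l → X⊆Y (p∈X l)) , indep

hasDim-unique : ∀ {d a a′} {S : Pred (Pt d) 0ℓ} → HasDim S a → HasDim S a′ → a ≡ a′
hasDim-unique {a = a} {a′} {S} (lo , hi) (lo′ , hi′) with ℕP.<-cmp a a′
... | tri< a<a′ _ _ = ⊥-elim (hi (hasAffIndep-≤ {S = S} (ℕ.s≤s a<a′) lo′))
... | tri≈ _ a≡a′ _ = a≡a′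
... | tri> _ _ a>a′ = ⊥-elim (hi′ (hasAffIndep-≤ {S = S} (ℕ.s≤s a>a′) lo))

if-then-0 : ∀ {d} β (p : Pt d) c → (if β then p else (λ _ → 0ℚ)) c ≡ 𝟙 β * p c
if-then-0 true  p c = sym (*-identityˡ (p c))
if-then-0 false p c = sym (*-zeroˡ (p c))

∈?-lookup : ∀ {m} (k : Fin m) (S : Subset m) → ⌊ k ∈? S ⌋ ≡ lookup S k
∈?-lookup zero    (true  ∷ S) = refl
∈?-lookup zero    (false ∷ S) = refl
∈?-lookup (suc k) (s ∷ S) with k ∈? S | ∈?-lookup k S
... | yes _ | e = e
... | no  _ | e = e

punchIn-cover : ∀ {m} (a k : Fin (suc m)) → k ≡ a ⊎ ∃[ t ] k ≡ punchIn a t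
punchIn-cover a k with a Fin.≟ k
... | yes a≡k = inj₁ (sym a≡k)
... | no  a≢k = inj₂ (punchOut a≢k , sym (punchIn-punchOut a≢k))

cover-except₂ : ∀ {m} {i j : Fin (suc (suc m))} → i ≢ j →
  Σ (Fin m → Fin (suc (suc m))) λ q → ∀ k → k ≡ i ⊎ k ≡ j ⊎ ∃[ t ] k ≡ q t
cover-except₂ {i = i} {j} i≢j = (λ t → punchIn j (punchIn i′ t)) , cover
  where
  j≢i : j ≢ i
  j≢i j≡i = i≢j (sym j≡i)
  i′ = punchOut j≢i
  cover : ∀ k → k ≡ i ⊎ k ≡ j ⊎ ∃[ t ] k ≡ punchIn j (punchIn i′ t)
  cover k with punchIn-cover j k
  ... | inj₁ k≡j = inj₂ (inj₁ k≡j)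
  ... | inj₂ (k′ , refl) with punchIn-cover i′ k′
  ...   | inj₁ refl       = inj₁ (punchIn-punchOut j≢i)
  ...   | inj₂ (t , refl) = inj₂ (inj₂ (t , refl))

cover-except₃ : ∀ {m} {i j k : Fin (suc (suc m))} → i ≢ j → k ≢ i → k ≢ j →
  ∃[ r ] (suc r ≡ m × Σ (Fin r → Fin (suc (suc m))) λ q → ∀ x → x ≡ i ⊎ x ≡ j ⊎ x ≡ k ⊎ ∃[ t ] x ≡ q t)
cover-except₃ {zero} i≢j k≢i k≢j with proj₂ (cover-except₂ i≢j) _
... | inj₁ k≡i        = ⊥-elim (k≢i k≡i)
... | inj₂ (inj₁ k≡j) = ⊥-elim (k≢j k≡j)
... | inj₂ (inj₂ (() , _))
cover-except₃ {suc m} {i} {j} {k} i≢j k≢i k≢j = m , refl , (λ t → punchIn k (q t)) , cover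
  where
  i′≢j′ : punchOut k≢i ≢ punchOut k≢j
  i′≢j′ e = i≢j (punchOut-injective k≢i k≢j e)
  q = proj₁ (cover-except₂ i′≢j′)
  cover : ∀ x → x ≡ i ⊎ x ≡ j ⊎ x ≡ k ⊎ ∃[ t ] x ≡ punchIn k (q t)
  cover x with punchIn-cover k x
  ... | inj₁ x≡k = inj₂ (inj₂ (inj₁ x≡k))
  ... | inj₂ (x′ , refl) with proj₂ (cover-except₂ i′≢j′) x′
  ...   | inj₁ refl              = inj₁ (punchIn-punchOut k≢i)
  ...   | inj₂ (inj₁ refl)       = inj₂ (inj₁ (punchIn-punchOut k≢j))
  ...   | inj₂ (inj₂ (t , refl)) = inj₂ (inj₂ (inj₂ (t , refl)))

fixed-at : ∀ {m} {Good : Subset m → Set} {x y β} → x ≡ y → (∀ S → Good S → lookup S y ≡ β) →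
  ∃[ β ] ∀ S → Good S → lookup S x ≡ β
fixed-at refl fixed = _ , fixed

true≢false : true ≢ false
true≢false ()

lookup≡false⇒∉ : ∀ {m} {S : Subset m} {j} → lookup S j ≡ false → j ∉ S
lookup≡false⇒∉ eq j∈S = true≢false (trans (sym ([]=⇒lookup j∈S)) eq)

∉⇒lookup≡false : ∀ {m} {S : Subset m} {j} → j ∉ S → lookup S j ≡ false
∉⇒lookup≡false {S = S} {j} j∉S with lookup S j in eq
... | true  = ⊥-elim (j∉S (lookup⇒[]= j S eq))
... | false = refl

-- Convex hulls and linear functionals

Conv-mono : ∀ {d} {X Y : Pred (Pt d) 0ℓ} → X ⊆ Y → Conv X ⊆ Conv Y
Conv-mono X⊆Y (k , p , w , p∈X , rest) = k , p , w , (λ i → X⊆Y (p∈X i)) , rest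

⊆Conv : ∀ {d} {X : Pred (Pt d) 0ℓ} → X ⊆ Conv X
⊆Conv {x = x} x∈X = 1 , (λ _ → x) , (λ _ → 1ℚ) , (λ _ → x∈X) , (λ _ → nonNegative⁻¹ 1ℚ) , refl ,
  λ c → sym (trans (+-identityʳ (1ℚ * x c)) (*-identityˡ (x c)))

Conv-resp : ∀ {d} {X : Pred (Pt d) 0ℓ} {x x′ : Pt d} → Conv X x → (∀ c → x c ≡ x′ c) → Conv X x′
Conv-resp (k , p , w , p∈X , w≥0 , Σw≡1 , x≡Σwp) x≗x′ =
  k , p , w , p∈X , w≥0 , Σw≡1 , λ c → trans (sym (x≗x′ c)) (x≡Σwp c)

·-cong : ∀ {d} (v : Pt d) {x y : Pt d} → (∀ c → x c ≡ y c) → v · x ≡ v · y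
·-cong v x≗y = Σℚ-cong (λ c → cong (v c *_) (x≗y c))

·-combination : ∀ {d m} (v x : Pt d) (w : Fin m → ℚ) (p : Fin m → Pt d) →
  (∀ c → x c ≡ Σℚ (λ l → w l * p l c)) → v · x ≡ Σℚ (λ l → w l * (v · p l))
·-combination v x w p x≡Σwp = begin
  Σℚ (λ c → v c * x c)                            ≡⟨ ·-cong v x≡Σwp ⟩
  Σℚ (λ c → v c * Σℚ (λ l → w l * p l c))         ≡⟨ Σℚ-cong (λ c → sym (Σℚ-*ˡ (v c) (λ l → w l * p l c))) ⟩
  Σℚ (λ c → Σℚ (λ l → v c * (w l * p l c)))       ≡⟨ Σℚ-comm (λ c l → v c * (w l * p l c)) ⟩
  Σℚ (λ l → Σℚ (λ c → v c * (w l * p l c)))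
    ≡⟨ Σℚ-cong (λ l → trans (Σℚ-cong (λ c → solve 3 (λ u y z → u :* (y :* z) := y :* (u :* z)) refl (v c) (w l) (p l c)))
                             (Σℚ-*ˡ (w l) (λ c → v c * p l c))) ⟩
  Σℚ (λ l → w l * (v · p l))                      ∎
  where open ≡-Reasoning

Conv-·≤ : ∀ {d} {X : Pred (Pt d) 0ℓ} (v : Pt d) (δ : ℚ) → (∀ {z} → X z → v · z ≤ δ) → ∀ {x} → Conv X x → v · x ≤ δ
Conv-·≤ v δ X≤δ (k , p , w , p∈X , w≥0 , Σw≡1 , x≡Σwp) =
  subst (_≤ δ) (sym (·-combination v _ w p x≡Σwp)) (average-≤ w (λ l → v · p l) δ w≥0 Σw≡1 (λ l → X≤δ (p∈X l)))

Conv-·≡ : ∀ {d} {X : Pred (Pt d) 0ℓ} (v : Pt d) (δ : ℚ) → (∀ {z} → X z → v · z ≡ δ) → ∀ {x} → Conv X x → v · x ≡ δ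
Conv-·≡ v δ X≡δ (k , p , w , p∈X , w≥0 , Σw≡1 , x≡Σwp) =
  trans (·-combination v _ w p x≡Σwp) (average-const w (λ l → v · p l) δ Σw≡1 (λ l → X≡δ (p∈X l)))

nonZero-weight : ∀ {m} (w : Fin m → ℚ) → Σℚ w ≡ 1ℚ → ∃[ l ] w l ≢ 0ℚ
nonZero-weight w Σw≡1 with search (λ l → w l ≢ 0ℚ) (λ l → ¬? (w l ≟ 0ℚ))
... | inj₁ found = found
... | inj₂ none  = ⊥-elim (1≢0 (trans (sym Σw≡1) (Σℚ-zero (λ l → decidable-stable (w l ≟ 0ℚ) (none l)))))

-- The points of nonzero weight lie on the hyperplane; those of weight zero are replaced by one of them.
Conv-face : ∀ {d} {X : Pred (Pt d) 0ℓ} (v : Pt d) (δ : ℚ) → (∀ {z} → X z → v · z ≤ δ) →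
  ∀ {x} → Conv X x → v · x ≡ δ → Conv (λ z → X z × v · z ≡ δ) x
Conv-face {X = X} v δ X≤δ {x} (k , p , w , p∈X , w≥0 , Σw≡1 , x≡Σwp) v·x≡δ =
  k , p′ , w , p′∈face , w≥0 , Σw≡1 , x≡Σwp′
  where
  slack≡0 : ∀ l → w l * (δ - v · p l) ≡ 0ℚ
  slack≡0 = Σℚ-nonNeg≡0⇒≡0 (λ l → nonNeg*nonNeg (w≥0 l) (0≤q-p (X≤δ (p∈X l)))) (begin
    Σℚ (λ l → w l * (δ - v · p l))              ≡⟨ Σℚ-cong (λ l → *-distribˡ-+ (w l) δ (- (v · p l))) ⟩
    Σℚ (λ l → w l * δ + w l * - (v · p l))      ≡⟨ Σℚ-+ (λ l → w l * δ) (λ l → w l * - (v · p l)) ⟩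
    Σℚ (λ l → w l * δ) + Σℚ (λ l → w l * - (v · p l))
      ≡⟨ cong₂ _+_ (average-const w (λ _ → δ) δ Σw≡1 (λ _ → refl))
                   (trans (Σℚ-cong (λ l → sym (neg-distribʳ-* (w l) (v · p l)))) (Σℚ-neg (λ l → w l * (v · p l)))) ⟩
    δ - Σℚ (λ l → w l * (v · p l))              ≡⟨ cong (λ z → δ - z) (trans (sym (·-combination v x w p x≡Σwp)) v·x≡δ) ⟩
    δ - δ                                       ≡⟨ +-inverseʳ δ ⟩
    0ℚ                                          ∎)
    where open ≡-Reasoning
  tight : ∀ l → w l ≢ 0ℚ → v · p l ≡ δ
  tight l wl≢0 = sym (x∙y⁻¹≈ε⇒x≈y δ (v · p l) (*-cancelˡ-≡0 wl≢0 (slack≡0 l)))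
  l⁺ = proj₁ (nonZero-weight w Σw≡1)
  choose : ∀ l → Dec (w l ≡ 0ℚ) → Pt _
  choose l (yes _) = p l⁺
  choose l (no _)  = p l
  p′ : Fin k → Pt _
  p′ l = choose l (w l ≟ 0ℚ)
  p′∈face : ∀ l → X (p′ l) × v · p′ l ≡ δ
  p′∈face l with w l ≟ 0ℚ
  ... | yes _    = p∈X l⁺ , tight l⁺ (proj₂ (nonZero-weight w Σw≡1))
  ... | no wl≢0  = p∈X l , tight l wl≢0
  same-term : ∀ l c → w l * p l c ≡ w l * p′ l c
  same-term l c with w l ≟ 0ℚ
  ... | yes wl≡0 = trans (cong (_* p l c) wl≡0) (trans (*-zeroˡ (p l c)) (sym (trans (cong (_* p l⁺ c) wl≡0) (*-zeroˡ (p l⁺ c)))))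
  ... | no _     = refl
  x≡Σwp′ : ∀ c → x c ≡ Σℚ (λ l → w l * p′ l c)
  x≡Σwp′ c = trans (x≡Σwp c) (Σℚ-cong (λ l → same-term l c))

≐-sym : ∀ {d} {X Y : Pred (Pt d) 0ℓ} → X ≐ Y → Y ≐ X
≐-sym (X⊆Y , Y⊆X) = Y⊆X , X⊆Y

IsFacet-resp-≐ : ∀ {d} {P F G : Pred (Pt d) 0ℓ} → F ≐ G → IsFacet P F → IsFacet P G
IsFacet-resp-≐ {P = P} {F} {G} (F⊆G , G⊆F) ((v , δ , valid , F⇒tight , tight⇒F) , k , dimP , (lo , hi)) =
  (v , δ , valid , (λ z∈G → F⇒tight (G⊆F z∈G)) , (λ z∈P tight → F⊆G (tight⇒F z∈P tight))) ,
  k , dimP , (hasAffIndep-⊆ {X = F} F⊆G lo , λ h → hi (hasAffIndep-⊆ {X = G} G⊆F h))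

-- Sorting and telescoping

Descending : ∀ {n} → (Fin (suc n) → ℚ) → Set
Descending {zero}  z = ⊤
Descending {suc n} z = z (suc zero) ≤ z zero × Descending (λ j → z (suc j))

sortDescending : ∀ {n} (y : Fin (suc n) → ℚ) →
  Σ (Permutation′ (suc n)) λ σ → Descending (λ j → y (σ ⟨$⟩ʳ j)) × (∀ j → y j ≤ y (σ ⟨$⟩ʳ zero))
sortDescending {zero}  y = Perm.id , tt , λ { zero → ≤-refl }
sortDescending {suc n} y with argmax y
... | m , max with sortDescending (λ j → y (punchIn m j))
...   | σ , desc , _ = Perm.insert zero m σ , (max (punchIn m (σ ⟨$⟩ʳ zero)) , desc) , max

gaps : ∀ {n} (z : Fin (suc n) → ℚ) → Fin (suc n) → ℚ
gaps {zero}  z zero    = z zero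
gaps {suc n} z zero    = z zero - z (suc zero)
gaps {suc n} z (suc t) = gaps (λ j → z (suc j)) t

Σℚ-gaps : ∀ {n} (z : Fin (suc n) → ℚ) → Σℚ (gaps z) ≡ z zero
Σℚ-gaps {zero}  z = +-identityʳ (z zero)
Σℚ-gaps {suc n} z = trans (cong (z zero - z (suc zero) +_) (Σℚ-gaps (λ j → z (suc j))))
  (solve 2 (λ a b → (a :- b) :+ b := a) refl (z zero) (z (suc zero)))

gaps-telescope : ∀ {n} (z : Fin (suc n) → ℚ) (j : Fin (suc n)) → Σℚ (λ t → gaps z t * 𝟙 (toℕ j ≤ᵇ toℕ t)) ≡ z j
gaps-telescope {zero}  z zero    = trans (+-identityʳ (gaps z zero * 1ℚ)) (*-identityʳ (z zero))
gaps-telescope {suc n} z zero    = trans (Σℚ-cong (λ t → *-identityʳ (gaps z t))) (Σℚ-gaps z)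
gaps-telescope {suc n} z (suc j) =
  trans (cong₂ _+_ (*-zeroʳ (gaps z zero)) (Σℚ-cong (λ t → cong (λ β → gaps z (suc t) * 𝟙 β) (≤ᵇ-suc (toℕ j) (toℕ t)))))
        (trans (+-identityˡ _) (gaps-telescope (λ i → z (suc i)) j))
  where
  ≤ᵇ-suc : ∀ a b → (suc a ≤ᵇ suc b) ≡ (a ≤ᵇ b)
  ≤ᵇ-suc zero    b = refl
  ≤ᵇ-suc (suc a) b = refl

gaps-nonNeg : ∀ {n} (z : Fin (suc n) → ℚ) → Descending z → (∀ j → 0ℚ ≤ z j) → ∀ t → 0ℚ ≤ gaps z t
gaps-nonNeg {zero}  z _        z≥0 zero    = z≥0 zero
gaps-nonNeg {suc n} z (z₁≤z₀ , _) z≥0 zero = 0≤q-p z₁≤z₀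
gaps-nonNeg {suc n} z (_ , desc) z≥0 (suc t) = gaps-nonNeg (λ j → z (suc j)) desc (λ j → z≥0 (suc j)) t

-- The Laplacian and the polytope H_Del

module Polytope {n : ℕ} (A : Adj n) (A-sym : Symmetric A) (A-loopless : Loopless A) where

  adj : Fin (suc n) → Fin (suc n) → ℚ
  adj k c = ℕtoℚ (A k c)

  degree : Fin (suc n) → ℚ
  degree k = ℕtoℚ (deg A k)

  b≡δ*degree-adj : ∀ k c → b A k c ≡ δ k c * degree k - adj k c
  b≡δ*degree-adj k c = by-cases (k Fin.≟ c)
    where
    by-cases : (k≟c : Dec (k ≡ c)) → (if ⌊ k≟c ⌋ then degree k else - adj k c) ≡ 𝟙 ⌊ k≟c ⌋ * degree k - adj k c
    by-cases (yes refl) = begin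
      degree k                ≡⟨ solve 1 (λ x → x := con 1ℚ :* x :- con 0ℚ) refl (degree k) ⟩
      1ℚ * degree k - 0ℚ      ≡⟨ cong (λ z → 1ℚ * degree k - ℕtoℚ z) (sym (A-loopless k)) ⟩
      1ℚ * degree k - adj k k ∎
      where open ≡-Reasoning
    by-cases (no _) = solve 2 (λ d x → :- x := con 0ℚ :* d :- x) refl (degree k) (adj k c)

  b-sym : ∀ k c → b A k c ≡ b A c k
  b-sym k c = begin
    b A k c                    ≡⟨ b≡δ*degree-adj k c ⟩
    δ k c * degree k - adj k c ≡⟨ cong₂ (λ x z → x - ℕtoℚ z) (δ-*-swap k c degree) (A-sym k c) ⟩
    δ c k * degree c - adj c k ≡⟨ sym (b≡δ*degree-adj c k) ⟩
    b A c k                    ∎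
    where open ≡-Reasoning

  b-rowSum : ∀ k → Σℚ (b A k) ≡ 0ℚ
  b-rowSum k = begin
    Σℚ (b A k)                                      ≡⟨ Σℚ-cong (b≡δ*degree-adj k) ⟩
    Σℚ (λ c → δ k c * degree k - adj k c)           ≡⟨ Σℚ-- (λ c → δ k c * degree k) (adj k) ⟩
    Σℚ (λ c → δ k c * degree k) - Σℚ (adj k)        ≡⟨ cong₂ _-_ (Σℚ-δ k (λ _ → degree k)) (sym (ℕtoℚ-Σℕ (A k))) ⟩
    degree k - degree k                             ≡⟨ +-inverseʳ (degree k) ⟩
    0ℚ                                              ∎
    where open ≡-Reasoning

  b-colSum : ∀ c → Σℚ (λ k → b A k c) ≡ 0ℚ
  b-colSum c = trans (Σℚ-cong (λ k → b-sym k c)) (b-rowSum c)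

  Σb : (Fin (suc n) → ℚ) → Pt (suc n)
  Σb y c = Σℚ (λ k → y k * b A k c)

  Σb-shift : ∀ (y : Fin (suc n) → ℚ) (s : ℚ) c → Σb (λ k → y k - s) c ≡ Σb y c
  Σb-shift y s c = begin
    Σℚ (λ k → (y k - s) * b A k c)                    ≡⟨ Σℚ-cong (λ k → solve 3 (λ y s b → (y :- s) :* b := y :* b :- s :* b) refl (y k) s (b A k c)) ⟩
    Σℚ (λ k → y k * b A k c - s * b A k c)            ≡⟨ Σℚ-- (λ k → y k * b A k c) (λ k → s * b A k c) ⟩
    Σb y c - Σℚ (λ k → s * b A k c)                   ≡⟨ cong (λ z → Σb y c - z) (trans (Σℚ-*ˡ s (λ k → b A k c)) (trans (cong (s *_) (b-colSum c)) (*-zeroʳ s))) ⟩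
    Σb y c - 0ℚ                                       ≡⟨ solve 1 (λ x → x :- con 0ℚ := x) refl (Σb y c) ⟩
    Σb y c                                            ∎
    where open ≡-Reasoning

  Σb-differences : ∀ (y : Fin (suc n) → ℚ) c → Σb y c ≡ Σℚ (λ k → adj c k * (y c - y k))
  Σb-differences y c = begin
    Σℚ (λ k → y k * b A k c)                                   ≡⟨ Σℚ-cong (λ k → cong (y k *_) (trans (b-sym k c) (b≡δ*degree-adj c k))) ⟩
    Σℚ (λ k → y k * (δ c k * degree c - adj c k))
      ≡⟨ Σℚ-cong (λ k → solve 4 (λ y e d x → y :* (e :* d :- x) := e :* y :* d :- x :* y) refl (y k) (δ c k) (degree c) (adj c k)) ⟩
    Σℚ (λ k → δ c k * y k * degree c - adj c k * y k)         ≡⟨ Σℚ-- (λ k → δ c k * y k * degree c) (λ k → adj c k * y k) ⟩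
    Σℚ (λ k → δ c k * y k * degree c) - Σℚ (λ k → adj c k * y k)
      ≡⟨ cong (_- Σℚ (λ k → adj c k * y k)) (trans (Σℚ-*ʳ (degree c) (λ k → δ c k * y k)) (cong (_* degree c) (Σℚ-δ c y))) ⟩
    y c * degree c - Σℚ (λ k → adj c k * y k)                  ≡⟨ cong (λ z → y c * z - Σℚ (λ k → adj c k * y k)) (ℕtoℚ-Σℕ (A c)) ⟩
    y c * Σℚ (adj c) - Σℚ (λ k → adj c k * y k)
      ≡⟨ cong (_- Σℚ (λ k → adj c k * y k)) (trans (sym (Σℚ-*ˡ (y c) (adj c))) (Σℚ-cong (λ k → *-comm (y c) (adj c k)))) ⟩
    Σℚ (λ k → adj c k * y c) - Σℚ (λ k → adj c k * y k)       ≡⟨ sym (Σℚ-- (λ k → adj c k * y c) (λ k → adj c k * y k)) ⟩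
    Σℚ (λ k → adj c k * y c - adj c k * y k)                   ≡⟨ Σℚ-cong (λ k → solve 3 (λ a x z → a :* x :- a :* z := a :* (x :- z)) refl (adj c k) (y c) (y k)) ⟩
    Σℚ (λ k → adj c k * (y c - y k))                           ∎
    where open ≡-Reasoning

  module _ (ν : Fin (suc n) → ℚ) (Σbν≡0 : ∀ c → Σb ν c ≡ 0ℚ) where

    -- At a maximum i, Σb ν i is a sum of nonnegative terms adj i k * (ν i - ν k), so each vanishes.
    neighbour-of-max : ∀ {i k} → (∀ j → ν j ≤ ν i) → A i k ≢ 0 → ν k ≡ ν i
    neighbour-of-max {i} {k} max Aik≢0 = sym (x∙y⁻¹≈ε⇒x≈y (ν i) (ν k) (*-cancelˡ-≡0 (ℕtoℚ-≢0 Aik≢0) (terms-vanish k)))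
      where
      terms-vanish : ∀ k → adj i k * (ν i - ν k) ≡ 0ℚ
      terms-vanish = Σℚ-nonNeg≡0⇒≡0 (λ j → nonNeg*nonNeg (ℕtoℚ-nonNeg (A i j)) (0≤q-p (max j)))
                                     (trans (sym (Σb-differences ν i)) (Σbν≡0 i))

    reachable-from-max : ∀ {i k} → Reach A i k → (∀ j → ν j ≤ ν i) → ν k ≡ ν i
    reachable-from-max here            max = refl
    reachable-from-max (step Aij≢0 ij) max = trans (reachable-from-max ij (λ l → subst (ν l ≤_) (sym νj≡νi) (max l))) νj≡νi
      where νj≡νi = neighbour-of-max max Aij≢0

    Σb≡0⇒constant : Connected A → ∀ k → ν k ≡ ν zero
    Σb≡0⇒constant connected k = trans (reachable-from-max (connected i k) max) (sym (reachable-from-max (connected i zero) max))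
      where
      i   = proj₁ (argmax ν)
      max = proj₂ (argmax ν)

  𝟙S : Subset (suc n) → Fin (suc n) → ℚ
  𝟙S S k = 𝟙 (lookup S k)

  uS≡Σb𝟙S : ∀ S c → uS A S c ≡ Σb (𝟙S S) c
  uS≡Σb𝟙S S c = Σℚ-cong (λ k → trans (if-then-0 ⌊ k ∈? S ⌋ (b A k) c) (cong (λ β → 𝟙 β * b A k c) (∈?-lookup k S)))

  -- prefix σ t = {σ 0, …, σ t}
  prefix : Permutation′ (suc n) → Fin (suc n) → Subset (suc n)
  prefix σ t = tabulate (λ k → toℕ (σ ⟨$⟩ˡ k) ≤ᵇ toℕ t)

  uσ≡uS-prefix : ∀ σ t c → uσ A σ t c ≡ uS A (prefix σ t) c
  uσ≡uS-prefix σ t c = sym (begin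
    uS A (prefix σ t) c                                        ≡⟨ uS≡Σb𝟙S (prefix σ t) c ⟩
    Σℚ (λ k → 𝟙 (lookup (prefix σ t) k) * b A k c)             ≡⟨ Σℚ-cong (λ k → cong (λ β → 𝟙 β * b A k c) (lookup∘tabulate (λ k → toℕ (σ ⟨$⟩ˡ k) ≤ᵇ toℕ t) k)) ⟩
    Σℚ (λ k → 𝟙 (toℕ (σ ⟨$⟩ˡ k) ≤ᵇ toℕ t) * b A k c)           ≡⟨ Σℚ-permute (λ k → 𝟙 (toℕ (σ ⟨$⟩ˡ k) ≤ᵇ toℕ t) * b A k c) σ ⟩
    Σℚ (λ j → 𝟙 (toℕ (σ ⟨$⟩ˡ (σ ⟨$⟩ʳ j)) ≤ᵇ toℕ t) * b A (σ ⟨$⟩ʳ j) c)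
      ≡⟨ Σℚ-cong (λ j → cong (λ i → 𝟙 (toℕ i ≤ᵇ toℕ t) * b A (σ ⟨$⟩ʳ j) c) (inverseˡ σ {j})) ⟩
    Σℚ (λ j → 𝟙 (toℕ j ≤ᵇ toℕ t) * b A (σ ⟨$⟩ʳ j) c)           ≡⟨ sym (Σℚ-cong (λ j → if-then-0 (toℕ j ≤ᵇ toℕ t) (b A (σ ⟨$⟩ʳ j)) c)) ⟩
    uσ A σ t c                                                 ∎)
    where open ≡-Reasoning

  HDel-resp : ∀ {x x′} → HDel A x → (∀ c → x c ≡ x′ c) → HDel A x′
  HDel-resp (σ , x∈△σ) x≗x′ = σ , Conv-resp {X = λ x → ∃[ t ] (∀ c → x c ≡ uσ A σ t c)} x∈△σ x≗x′

  Vertex : (Subset (suc n) → Set) → Pred (Pt (suc n)) 0ℓ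
  Vertex Good x = ∃[ S ] (Good S × (∀ c → x c ≡ uS A S c))

  HDel⊆Conv-Vertex : HDel A ⊆ Conv (Vertex (λ _ → ⊤))
  HDel⊆Conv-Vertex (σ , x∈△σ) = Conv-mono {X = λ x → ∃[ t ] (∀ c → x c ≡ uσ A σ t c)} {Y = Vertex (λ _ → ⊤)}
    (λ (t , x≡uσ) → prefix σ t , tt , λ c → trans (x≡uσ c) (uσ≡uS-prefix σ t c)) x∈△σ

  Σb-combination : ∀ {m} (w : Fin m → ℚ) (y : Fin m → Fin (suc n) → ℚ) c →
    Σℚ (λ l → w l * Σb (y l) c) ≡ Σb (λ k → Σℚ (λ l → w l * y l k)) c
  Σb-combination w y c = begin
    Σℚ (λ l → w l * Σℚ (λ k → y l k * b A k c))       ≡⟨ Σℚ-cong (λ l → sym (Σℚ-*ˡ (w l) (λ k → y l k * b A k c))) ⟩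
    Σℚ (λ l → Σℚ (λ k → w l * (y l k * b A k c)))     ≡⟨ Σℚ-comm (λ l k → w l * (y l k * b A k c)) ⟩
    Σℚ (λ k → Σℚ (λ l → w l * (y l k * b A k c)))
      ≡⟨ Σℚ-cong (λ k → trans (Σℚ-cong (λ l → sym (*-assoc (w l) (y l k) (b A k c)))) (Σℚ-*ʳ (b A k c) (λ l → w l * y l k))) ⟩
    Σℚ (λ k → Σℚ (λ l → w l * y l k) * b A k c)       ∎
    where open ≡-Reasoning

  record Coefficients (Good : Subset (suc n) → Set) (x : Pt (suc n)) : Set where
    field
      y       : Fin (suc n) → ℚ
      x≡Σb    : ∀ c → x c ≡ Σb y c
      y≥0     : ∀ k → 0ℚ ≤ y k
      y≤1     : ∀ k → y k ≤ 1ℚ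
      y-fixed : ∀ k β → (∀ S → Good S → lookup S k ≡ β) → y k ≡ 𝟙 β

  coefficients : ∀ {Good x} → Conv (Vertex Good) x → Coefficients Good x
  coefficients {Good} {x} (m , p , w , p∈V , w≥0 , Σw≡1 , x≡Σwp) = record
    { y       = y
    ; x≡Σb    = λ c → trans (x≡Σwp c) (trans (Σℚ-cong (λ l → cong (w l *_) (p≡Σb l c))) (Σb-combination w (λ l → 𝟙S (S l)) c))
    ; y≥0     = λ k → Σℚ-nonNeg (λ l → nonNeg*nonNeg (w≥0 l) (𝟙-nonNeg (lookup (S l) k)))
    ; y≤1     = λ k → average-≤ w (λ l → 𝟙S (S l) k) 1ℚ w≥0 Σw≡1 (λ l → 𝟙≤1 (lookup (S l) k))
    ; y-fixed = λ k β fixed → average-const w (λ l → 𝟙S (S l) k) (𝟙 β) Σw≡1 (λ l → cong 𝟙 (fixed (S l) (proj₁ (proj₂ (p∈V l)))))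
    }
    where
    S : Fin m → Subset (suc n)
    S l = proj₁ (p∈V l)
    p≡Σb : ∀ l c → p l c ≡ Σb (𝟙S (S l)) c
    p≡Σb l c = trans (proj₂ (proj₂ (p∈V l)) c) (uS≡Σb𝟙S (S l) c)
    y : Fin (suc n) → ℚ
    y k = Σℚ (λ l → w l * 𝟙S (S l) k)

  -- With z the values of y in decreasing order, Σb y is the convex combination of the vertices
  -- u^σ_t of △σ with the weights z t - z (t+1).
  Σb∈HDel : ∀ y → (∀ k → 0ℚ ≤ y k) → (∀ k → y k ≤ 1ℚ) → ∀ i → y i ≡ 1ℚ → HDel A (Σb y)
  Σb∈HDel y y≥0 y≤1 i yi≡1 =
    σ , suc n , uσ A σ , gaps z , (λ t → t , λ c → refl) , gaps-nonNeg z desc (λ j → y≥0 (σ ⟨$⟩ʳ j)) , Σgaps≡1 , Σb≡Σgaps-uσ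
    where
    σ    = proj₁ (sortDescending y)
    desc = proj₁ (proj₂ (sortDescending y))
    max  = proj₂ (proj₂ (sortDescending y))
    z : Fin (suc n) → ℚ
    z j = y (σ ⟨$⟩ʳ j)
    Σgaps≡1 : Σℚ (gaps z) ≡ 1ℚ
    Σgaps≡1 = trans (Σℚ-gaps z) (≤-antisym (y≤1 (σ ⟨$⟩ʳ zero)) (subst (_≤ z zero) yi≡1 (max i)))
    Σb≡Σgaps-uσ : ∀ c → Σb y c ≡ Σℚ (λ t → gaps z t * uσ A σ t c)
    Σb≡Σgaps-uσ c = sym (begin
      Σℚ (λ t → gaps z t * uσ A σ t c)
        ≡⟨ Σℚ-cong (λ t → trans (cong (gaps z t *_) (Σℚ-cong (λ j → if-then-0 (le j t) (b A (σ ⟨$⟩ʳ j)) c)))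
                                (sym (Σℚ-*ˡ (gaps z t) (λ j → 𝟙 (le j t) * b A (σ ⟨$⟩ʳ j) c)))) ⟩
      Σℚ (λ t → Σℚ (λ j → gaps z t * (𝟙 (le j t) * b A (σ ⟨$⟩ʳ j) c)))
        ≡⟨ Σℚ-comm (λ t j → gaps z t * (𝟙 (le j t) * b A (σ ⟨$⟩ʳ j) c)) ⟩
      Σℚ (λ j → Σℚ (λ t → gaps z t * (𝟙 (le j t) * b A (σ ⟨$⟩ʳ j) c)))
        ≡⟨ Σℚ-cong (λ j → trans (Σℚ-cong (λ t → sym (*-assoc (gaps z t) (𝟙 (le j t)) (b A (σ ⟨$⟩ʳ j) c))))
                                (Σℚ-*ʳ (b A (σ ⟨$⟩ʳ j) c) (λ t → gaps z t * 𝟙 (le j t)))) ⟩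
      Σℚ (λ j → Σℚ (λ t → gaps z t * 𝟙 (le j t)) * b A (σ ⟨$⟩ʳ j) c)
        ≡⟨ Σℚ-cong (λ j → cong (_* b A (σ ⟨$⟩ʳ j) c) (gaps-telescope z j)) ⟩
      Σℚ (λ j → y (σ ⟨$⟩ʳ j) * b A (σ ⟨$⟩ʳ j) c)
        ≡⟨ sym (Σℚ-permute (λ k → y k * b A k c) σ) ⟩
      Σb y c ∎)
      where
      open ≡-Reasoning
      le : Fin (suc n) → Fin (suc n) → Bool
      le j t = toℕ j ≤ᵇ toℕ t

  Conv-Vertex⊆HDel : ∀ {Good} i → (∀ S → Good S → lookup S i ≡ true) → Conv (Vertex Good) ⊆ HDel A
  Conv-Vertex⊆HDel i i∈Good x∈conv = HDel-resp (Σb∈HDel y y≥0 y≤1 i (y-fixed i true i∈Good)) (λ c → sym (x≡Σb c))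
    where open Coefficients (coefficients x∈conv)

  rowValue : Pt (suc n) → Fin (suc n) → ℚ
  rowValue v k = v · b A k

  ·-Σb : ∀ (v : Pt (suc n)) y → v · Σb y ≡ Σℚ (λ k → y k * rowValue v k)
  ·-Σb v y = ·-combination v (Σb y) y (b A) (λ c → refl)

  ·-uS : ∀ (v : Pt (suc n)) S → v · uS A S ≡ Σℚ (λ k → 𝟙S S k * rowValue v k)
  ·-uS v S = trans (·-cong v (uS≡Σb𝟙S S)) (·-Σb v (𝟙S S))

  rowValue≡Σb : ∀ v k → rowValue v k ≡ Σb v k
  rowValue≡Σb v k = Σℚ-cong (λ c → cong (v c *_) (b-sym k c))

  Σℚ-Σb : ∀ y → Σℚ (Σb y) ≡ 0ℚ
  Σℚ-Σb y = trans (Σℚ-comm (λ c k → y k * b A k c))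
    (Σℚ-zero (λ k → trans (Σℚ-*ˡ (y k) (b A k)) (trans (cong (y k *_) (b-rowSum k)) (*-zeroʳ (y k)))))

  Σℚ-rowValue : ∀ v → Σℚ (rowValue v) ≡ 0ℚ
  Σℚ-rowValue v = trans (Σℚ-cong (rowValue≡Σb v)) (Σℚ-Σb v)

  Conv-Vertex-mono : ∀ {Good Good′} → (∀ S → Good S → Good′ S) → Conv (Vertex Good) ⊆ Conv (Vertex Good′)
  Conv-Vertex-mono {Good} {Good′} G⇒G′ =
    Conv-mono {X = Vertex Good} {Y = Vertex Good′} (λ (S , good , x≡uS) → S , G⇒G′ S good , x≡uS)

  Conv-Vertex-·≡ : ∀ {Good} v α → (∀ S → Good S → v · uS A S ≡ α) → ∀ {x} → Conv (Vertex Good) x → v · x ≡ α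
  Conv-Vertex-·≡ {Good} v α good⇒α = Conv-·≡ {X = Vertex Good} v α (λ (S , good , x≡uS) → trans (·-cong v x≡uS) (good⇒α S good))

  HDel-·≤ : ∀ v α → (∀ S → v · uS A S ≤ α) → ∀ {x} → HDel A x → v · x ≤ α
  HDel-·≤ v α uS≤α x∈P =
    Conv-·≤ {X = Vertex (λ _ → ⊤)} v α (λ (S , _ , x≡uS) → subst (_≤ α) (sym (·-cong v x≡uS)) (uS≤α S)) (HDel⊆Conv-Vertex x∈P)

  HDel-face : ∀ {Good} v α → (∀ S → v · uS A S ≤ α) → (∀ S → v · uS A S ≡ α → Good S) →
    ∀ {x} → HDel A x → v · x ≡ α → Conv (Vertex Good) x
  HDel-face {Good} v α uS≤α tight⇒good x∈P v·x≡α =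
    Conv-mono {X = λ z → Vertex (λ _ → ⊤) z × v · z ≡ α} {Y = Vertex Good}
      (λ ((S , _ , x≡uS) , v·x≡α) → S , tight⇒good S (trans (sym (·-cong v x≡uS)) v·x≡α) , x≡uS)
      (Conv-face {X = Vertex (λ _ → ⊤)} v α (λ (S , _ , x≡uS) → subst (_≤ α) (sym (·-cong v x≡uS)) (uS≤α S))
                 (HDel⊆Conv-Vertex x∈P) v·x≡α)

  -- If outside r coordinates q the coefficient vectors of r + 2 points agree, the points satisfy
  -- an affine relation read off from a linear relation among the r + 2 vectors (1, y_l ∘ q) in ℚ^(r+1).
  few-free-coordinates⇒¬AffIndep : ∀ {r} (p : Fin (suc (suc r)) → Pt (suc n)) (y : Fin (suc (suc r)) → Fin (suc n) → ℚ) →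
    (∀ l c → p l c ≡ Σb (y l) c) → (q : Fin r → Fin (suc n)) →
    (∀ k → (∀ l → y l k ≡ y zero k) ⊎ ∃[ t ] k ≡ q t) → ¬ AffIndep p
  few-free-coordinates⇒¬AffIndep {r} p y p≡Σby q cover indep = contradiction (rows-dependent (suc r) rows)
    where
    rows : Fin (suc (suc r)) → Fin (suc r) → ℚ
    rows l zero    = 1ℚ
    rows l (suc t) = y l (q t)
    contradiction : NontrivialRelation rows → ⊥
    contradiction (μ , (l , μl≢0) , rel) = μl≢0 (indep μ Σμ≡0 Σμp≡0 l)
      where
      Σμ≡0 : Σℚ μ ≡ 0ℚ
      Σμ≡0 = trans (Σℚ-cong (λ l → sym (*-identityʳ (μ l)))) (rel zero)
      Σμy≡0 : ∀ k → Σℚ (λ l → μ l * y l k) ≡ 0ℚ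
      Σμy≡0 k = [ fixed-coordinate , free-coordinate ]′ (cover k)
        where
        fixed-coordinate : (∀ l → y l k ≡ y zero k) → Σℚ (λ l → μ l * y l k) ≡ 0ℚ
        fixed-coordinate fixed = trans (Σℚ-cong (λ l → cong (μ l *_) (fixed l)))
          (trans (Σℚ-*ʳ (y zero k) μ) (trans (cong (_* y zero k) Σμ≡0) (*-zeroˡ (y zero k))))
        free-coordinate : ∃[ t ] k ≡ q t → Σℚ (λ l → μ l * y l k) ≡ 0ℚ
        free-coordinate (t , refl) = rel (suc t)
      Σμp≡0 : ∀ c → Σℚ (λ l → μ l * p l c) ≡ 0ℚ
      Σμp≡0 c = begin
        Σℚ (λ l → μ l * p l c)                       ≡⟨ Σℚ-cong (λ l → cong (μ l *_) (p≡Σby l c)) ⟩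
        Σℚ (λ l → μ l * Σb (y l) c)                  ≡⟨ Σb-combination μ y c ⟩
        Σb (λ k → Σℚ (λ l → μ l * y l k)) c          ≡⟨ Σℚ-zero (λ k → trans (cong (_* b A k c) (Σμy≡0 k)) (*-zeroˡ (b A k c))) ⟩
        0ℚ                                           ∎
        where open ≡-Reasoning

  b∈HDel : ∀ k → HDel A (b A k)
  b∈HDel k = HDel-resp (Σb∈HDel (δ k) (λ j → 𝟙-nonNeg ⌊ k Fin.≟ j ⌋) (λ j → 𝟙≤1 ⌊ k Fin.≟ j ⌋) k (δ-refl k))
                       (λ c → Σℚ-δ k (λ j → b A j c))

  HDel-upper : ¬ HasAffIndep (HDel A) (suc (suc n))
  HDel-upper (p , p∈HDel , indep) = few-free-coordinates⇒¬AffIndep p y′ p≡Σby′ suc cover indep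
    where
    y : Fin (suc (suc n)) → Fin (suc n) → ℚ
    y l = Coefficients.y (coefficients (HDel⊆Conv-Vertex (p∈HDel l)))
    y′ : Fin (suc (suc n)) → Fin (suc n) → ℚ
    y′ l k = y l k - y l zero
    p≡Σby′ : ∀ l c → p l c ≡ Σb (y′ l) c
    p≡Σby′ l c = trans (Coefficients.x≡Σb (coefficients (HDel⊆Conv-Vertex (p∈HDel l))) c) (sym (Σb-shift (y l) (y l zero) c))
    cover : ∀ k → (∀ l → y′ l k ≡ y′ zero k) ⊎ ∃[ t ] k ≡ suc t
    cover zero    = inj₁ (λ l → trans (+-inverseʳ (y l zero)) (sym (+-inverseʳ (y zero zero))))
    cover (suc t) = inj₂ (t , refl)

  Conv-Vertex-upper : ∀ {r Good} (q : Fin r → Fin (suc n)) →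
    (∀ k → (∃[ β ] ∀ S → Good S → lookup S k ≡ β) ⊎ ∃[ t ] k ≡ q t) →
    ¬ HasAffIndep (Conv (Vertex Good)) (suc (suc r))
  Conv-Vertex-upper q cover (p , p∈conv , indep) = few-free-coordinates⇒¬AffIndep p y x≡Σb q cover′ indep
    where
    y : Fin _ → Fin (suc n) → ℚ
    y l = Coefficients.y (coefficients (p∈conv l))
    x≡Σb : ∀ l c → p l c ≡ Σb (y l) c
    x≡Σb l = Coefficients.x≡Σb (coefficients (p∈conv l))
    cover′ : ∀ k → (∀ l → y l k ≡ y zero k) ⊎ ∃[ t ] k ≡ q t
    cover′ k = map₁ (λ (β , fixed) l → trans (y-fixed l k β fixed) (sym (y-fixed zero k β fixed))) (cover k)
      where y-fixed = λ l → Coefficients.y-fixed (coefficients (p∈conv l))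

  Between : Fin (suc n) → Fin (suc n) → Subset (suc n) → Set
  Between i j S = i ∈ S × j ∉ S

  Conv-Fij≐Conv-Vertex : ∀ i j → Conv (Fij A i j) ≐ Conv (Vertex (Between i j))
  Conv-Fij≐Conv-Vertex i j =
    Conv-mono {X = Fij A i j} {Y = Vertex (Between i j)} (λ (S , i∈S , j∉S , x≡uS) → S , (i∈S , j∉S) , x≡uS) ,
    Conv-mono {X = Vertex (Between i j)} {Y = Fij A i j} (λ (S , (i∈S , j∉S) , x≡uS) → S , i∈S , j∉S , x≡uS)

-- Facets

module Facets {m : ℕ} (A : Adj (suc m)) (A-sym : Symmetric A) (A-loopless : Loopless A) (connected : Connected A) where

  open Polytope A A-sym A-loopless

  N : ℕ
  N = suc (suc m)

  b-affIndep : AffIndep (b A)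
  b-affIndep μ Σμ≡0 Σμb≡0 k = trans (constant k) μ₀≡0
    where
    constant : ∀ k → μ k ≡ μ zero
    constant = Σb≡0⇒constant μ Σμb≡0 connected
    μ₀≡0 : μ zero ≡ 0ℚ
    μ₀≡0 = *-cancelˡ-≡0 (ℕtoℚ-≢0 {N} (λ ()))
      (trans (sym (Σℚ-const N (μ zero))) (trans (Σℚ-cong (λ l → sym (constant l))) Σμ≡0))

  HDel-dim : HasDim (HDel A) (suc m)
  HDel-dim = (b A , b∈HDel , b-affIndep) , HDel-upper

  -- The vertices u_{i,k} for k ≠ j (with u_{i,i} = u_{i}).
  Fij-lower : ∀ {i j} → i ≢ j → HasAffIndep (Conv (Fij A i j)) (suc m)
  Fij-lower {i} {j} i≢j = p , (λ l → ⊆Conv {X = Fij A i j} (S l , i∈S l , j∉S l , λ c → refl)) , indep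
    where
    S : Fin (suc m) → Subset N
    S l = tabulate (λ x → ⌊ x Fin.≟ i ⌋ ∨ ⌊ x Fin.≟ punchIn j l ⌋)
    lookup-S : ∀ l x → lookup (S l) x ≡ ⌊ x Fin.≟ i ⌋ ∨ ⌊ x Fin.≟ punchIn j l ⌋
    lookup-S l = lookup∘tabulate (λ x → ⌊ x Fin.≟ i ⌋ ∨ ⌊ x Fin.≟ punchIn j l ⌋)
    i∈S : ∀ l → i ∈ S l
    i∈S l = lookup⇒[]= i (S l) (trans (lookup-S l i) (cong (_∨ ⌊ i Fin.≟ punchIn j l ⌋) (⌊⌋-true (i Fin.≟ i) refl)))
    j∉S′ : ∀ l → lookup (S l) j ≡ false
    j∉S′ l = trans (lookup-S l j) (cong₂ _∨_ (⌊⌋-false (j Fin.≟ i) (λ j≡i → i≢j (sym j≡i)))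
                                            (⌊⌋-false (j Fin.≟ punchIn j l) (λ e → punchInᵢ≢i j l (sym e))))
    j∉S : ∀ l → j ∉ S l
    j∉S l = lookup≡false⇒∉ (j∉S′ l)
    p : Fin (suc m) → Pt N
    p l = uS A (S l)
    indep : AffIndep p
    indep μ Σμ≡0 Σμp≡0 = μ≡0
      where
      ν : Fin N → ℚ
      ν x = Σℚ (λ l → μ l * 𝟙S (S l) x)
      ν≡0 : ∀ x → ν x ≡ 0ℚ
      ν≡0 x = trans (constant x) (trans (sym (constant j)) (Σℚ-zero (λ l → trans (cong (λ β → μ l * 𝟙 β) (j∉S′ l)) (*-zeroʳ (μ l)))))
        where
        Σbν≡0 : ∀ c → Σb ν c ≡ 0ℚ
        Σbν≡0 c = trans (sym (Σb-combination μ (λ l → 𝟙S (S l)) c))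
                        (trans (Σℚ-cong (λ l → cong (μ l *_) (sym (uS≡Σb𝟙S (S l) c)))) (Σμp≡0 c))
        constant = Σb≡0⇒constant ν Σbν≡0 connected
      μ-off-i : ∀ l → punchIn j l ≢ i → μ l ≡ 0ℚ
      μ-off-i l k≢i = trans (sym (trans (Σℚ-single _ l only-l) at-l)) (ν≡0 (punchIn j l))
        where
        k = punchIn j l
        only-l : ∀ l′ → l′ ≢ l → μ l′ * 𝟙S (S l′) k ≡ 0ℚ
        only-l l′ l′≢l = trans (cong (λ β → μ l′ * 𝟙 β) (trans (lookup-S l′ k)
          (cong₂ _∨_ (⌊⌋-false (k Fin.≟ i) k≢i) (⌊⌋-false (k Fin.≟ punchIn j l′) (λ e → l′≢l (sym (punchIn-injective j l l′ e)))))))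
          (*-zeroʳ (μ l′))
        at-l : μ l * 𝟙S (S l) k ≡ μ l
        at-l = trans (cong (λ β → μ l * 𝟙 β) (trans (lookup-S l k) (trans (cong (⌊ k Fin.≟ i ⌋ ∨_) (⌊⌋-true (k Fin.≟ k) refl)) (∨-zeroʳ ⌊ k Fin.≟ i ⌋))))
                     (*-identityʳ (μ l))
      -- the remaining coefficient, of u_{i}, is then forced by Σ μ = 0
      μ≡0 : ∀ l → μ l ≡ 0ℚ
      μ≡0 l = by-cases (punchIn j l Fin.≟ i)
        where
        by-cases : Dec (punchIn j l ≡ i) → μ l ≡ 0ℚ
        by-cases (no  k≢i) = μ-off-i l k≢i
        by-cases (yes k≡i) = trans (sym (Σℚ-single μ l others≡0)) Σμ≡0
          where
          others≡0 : ∀ l′ → l′ ≢ l → μ l′ ≡ 0ℚ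
          others≡0 l′ l′≢l = μ-off-i l′ (λ e → l′≢l (punchIn-injective j l′ l (trans e (sym k≡i))))

  Fij-upper : ∀ {i j} → i ≢ j → ¬ HasAffIndep (Conv (Fij A i j)) (suc (suc m))
  Fij-upper {i} {j} i≢j h = Conv-Vertex-upper q cover (hasAffIndep-⊆ {X = Conv (Fij A i j)} (proj₁ (Conv-Fij≐Conv-Vertex i j)) h)
    where
    q = proj₁ (cover-except₂ i≢j)
    cover : ∀ k → (∃[ β ] ∀ S → Between i j S → lookup S k ≡ β) ⊎ ∃[ t ] k ≡ q t
    cover k = [ (λ k≡i → inj₁ (fixed-at k≡i (λ S (i∈S , _) → []=⇒lookup i∈S))) ,
                [ (λ k≡j → inj₁ (fixed-at k≡j (λ S (_ , j∉S) → ∉⇒lookup≡false j∉S))) , inj₂ ]′ ]′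
              (proj₂ (cover-except₂ i≢j) k)

  Fij-dim : ∀ {i j} → i ≢ j → HasDim (Conv (Fij A i j)) m
  Fij-dim i≢j = Fij-lower i≢j , Fij-upper i≢j

  restrictedRows : (Fin N → ℚ) → Fin N → Fin (suc m) → ℚ
  restrictedRows t zero    c = t (suc c)
  restrictedRows t (suc k) c = b A (suc k) (suc c)

  zeroFirst : (Fin N → ℚ) → Fin N → ℚ
  zeroFirst μ zero    = 0ℚ
  zeroFirst μ (suc k) = μ (suc k)

  -- A relation among t and b_1, …, b_n on the coordinates 1, …, n also holds at coordinate 0,
  -- since t and every Σb y sum to zero.
  relation-restrictedRows : ∀ t → Σℚ t ≡ 0ℚ → ∀ μ → (∀ c → Σℚ (λ l → μ l * restrictedRows t l c) ≡ 0ℚ) →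
    ∀ c → Σb (zeroFirst μ) c + μ zero * t c ≡ 0ℚ
  relation-restrictedRows t Σt≡0 μ rel = g≡0
    where
    g : Fin N → ℚ
    g c = Σb (zeroFirst μ) c + μ zero * t c
    g-suc : ∀ c → g (suc c) ≡ 0ℚ
    g-suc c = trans (solve 3 (λ a x u → (a :+ x) :+ u := u :+ x :+ a) refl
                      (0ℚ * b A zero (suc c)) (Σℚ (λ k → μ (suc k) * b A (suc k) (suc c))) (μ zero * t (suc c)))
              (trans (cong (μ zero * t (suc c) + Σℚ (λ k → μ (suc k) * b A (suc k) (suc c)) +_) (*-zeroˡ (b A zero (suc c))))
              (trans (+-identityʳ (μ zero * t (suc c) + Σℚ (λ k → μ (suc k) * b A (suc k) (suc c)))) (rel c)))
    Σg≡0 : Σℚ g ≡ 0ℚ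
    Σg≡0 = trans (Σℚ-+ (Σb (zeroFirst μ)) (λ c → μ zero * t c))
      (trans (cong₂ _+_ (Σℚ-Σb (zeroFirst μ)) (trans (Σℚ-*ˡ (μ zero) t) (trans (cong (μ zero *_) Σt≡0) (*-zeroʳ (μ zero)))))
             (+-identityˡ 0ℚ))
    g≡0 : ∀ c → g c ≡ 0ℚ
    g≡0 zero    = trans (sym (+-identityʳ (g zero))) (trans (cong (g zero +_) (sym (Σℚ-zero g-suc))) Σg≡0)
    g≡0 (suc c) = g-suc c

  coefficient-of-t≢0 : ∀ t → Σℚ t ≡ 0ℚ → ∀ μ l → μ l ≢ 0ℚ →
    (∀ c → Σℚ (λ l → μ l * restrictedRows t l c) ≡ 0ℚ) → μ zero ≢ 0ℚ
  coefficient-of-t≢0 t Σt≡0 μ l μl≢0 rel μ₀≡0 = μl≢0 (μ≡0 l)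
    where
    Σbν≡0 : ∀ c → Σb (zeroFirst μ) c ≡ 0ℚ
    Σbν≡0 c = begin
      Σb (zeroFirst μ) c                       ≡⟨ sym (+-identityʳ (Σb (zeroFirst μ) c)) ⟩
      Σb (zeroFirst μ) c + 0ℚ                  ≡⟨ cong (Σb (zeroFirst μ) c +_) (sym (trans (cong (_* t c) μ₀≡0) (*-zeroˡ (t c)))) ⟩
      Σb (zeroFirst μ) c + μ zero * t c        ≡⟨ relation-restrictedRows t Σt≡0 μ rel c ⟩
      0ℚ                                       ∎
      where open ≡-Reasoning
    μ≡0 : ∀ l → μ l ≡ 0ℚ
    μ≡0 zero    = μ₀≡0
    μ≡0 (suc k) = Σb≡0⇒constant (zeroFirst μ) Σbν≡0 connected (suc k)

  Σb-onto-sumZero : (t : Fin N → ℚ) → Σℚ t ≡ 0ℚ → ∃[ v ] ∀ k → Σb v k ≡ t k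
  Σb-onto-sumZero t Σt≡0 = v , Σbv≡t
    where
    relation = rows-dependent (suc m) (restrictedRows t)
    μ   = proj₁ relation
    rel = proj₂ (proj₂ relation)
    μ₀≢0 : μ zero ≢ 0ℚ
    μ₀≢0 = coefficient-of-t≢0 t Σt≡0 μ (proj₁ (proj₁ (proj₂ relation))) (proj₂ (proj₁ (proj₂ relation))) rel
    μ₀⁻¹ : ℚ
    μ₀⁻¹ = (1/ μ zero) {{ℚ.≢-nonZero μ₀≢0}}
    μ₀*μ₀⁻¹≡1 : μ zero * μ₀⁻¹ ≡ 1ℚ
    μ₀*μ₀⁻¹≡1 = *-inverseʳ (μ zero) {{ℚ.≢-nonZero μ₀≢0}}
    v : Pt N
    v c = - μ₀⁻¹ * zeroFirst μ c
    Σbv≡t : ∀ k → Σb v k ≡ t k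
    Σbv≡t k = begin
      Σb v k                                     ≡⟨ Σℚ-cong (λ c → *-assoc (- μ₀⁻¹) (zeroFirst μ c) (b A c k)) ⟩
      Σℚ (λ c → - μ₀⁻¹ * (zeroFirst μ c * b A c k)) ≡⟨ Σℚ-*ˡ (- μ₀⁻¹) (λ c → zeroFirst μ c * b A c k) ⟩
      - μ₀⁻¹ * Σb (zeroFirst μ) k                ≡⟨ cong (- μ₀⁻¹ *_) (solve 2 (λ x y → x := (x :+ y) :- y) refl (Σb (zeroFirst μ) k) (μ zero * t k)) ⟩
      - μ₀⁻¹ * ((Σb (zeroFirst μ) k + μ zero * t k) - μ zero * t k)
                                                 ≡⟨ cong (λ z → - μ₀⁻¹ * (z - μ zero * t k)) (relation-restrictedRows t Σt≡0 μ rel k) ⟩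
      - μ₀⁻¹ * (0ℚ - μ zero * t k)               ≡⟨ solve 3 (λ i m t → (:- i) :* (con 0ℚ :- m :* t) := (m :* i) :* t) refl μ₀⁻¹ (μ zero) (t k) ⟩
      (μ zero * μ₀⁻¹) * t k                      ≡⟨ cong (_* t k) μ₀*μ₀⁻¹≡1 ⟩
      1ℚ * t k                                   ≡⟨ *-identityˡ (t k) ⟩
      t k                                        ∎
      where open ≡-Reasoning

  Fij-isFacet : ∀ {i j} → i ≢ j → IsFacet (HDel A) (Conv (Fij A i j))
  Fij-isFacet {i} {j} i≢j = (v , 1ℚ , valid , on-face , face⊆) , m , HDel-dim , Fij-dim i≢j
    where
    t : Fin N → ℚ
    t k = δ i k - δ j k
    Σt≡0 : Σℚ t ≡ 0ℚ
    Σt≡0 = trans (Σℚ-- (δ i) (δ j)) (trans (cong₂ _-_ (Σℚ-δ-1 i) (Σℚ-δ-1 j)) (+-inverseʳ 1ℚ))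
      where
      Σℚ-δ-1 : ∀ a → Σℚ (δ a) ≡ 1ℚ
      Σℚ-δ-1 a = trans (Σℚ-cong (λ k → sym (*-identityʳ (δ a k)))) (Σℚ-δ a (λ _ → 1ℚ))
    v = proj₁ (Σb-onto-sumZero t Σt≡0)
    value : ∀ S → v · uS A S ≡ 𝟙S S i - 𝟙S S j
    value S = begin
      v · uS A S                                         ≡⟨ ·-uS v S ⟩
      Σℚ (λ k → 𝟙S S k * rowValue v k)                   ≡⟨ Σℚ-cong (λ k → cong (𝟙S S k *_) (trans (rowValue≡Σb v k) (proj₂ (Σb-onto-sumZero t Σt≡0) k))) ⟩
      Σℚ (λ k → 𝟙S S k * (δ i k - δ j k))
        ≡⟨ Σℚ-cong (λ k → solve 3 (λ y a b → y :* (a :- b) := a :* y :- b :* y) refl (𝟙S S k) (δ i k) (δ j k)) ⟩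
      Σℚ (λ k → δ i k * 𝟙S S k - δ j k * 𝟙S S k)       ≡⟨ Σℚ-- (λ k → δ i k * 𝟙S S k) (λ k → δ j k * 𝟙S S k) ⟩
      Σℚ (λ k → δ i k * 𝟙S S k) - Σℚ (λ k → δ j k * 𝟙S S k) ≡⟨ cong₂ _-_ (Σℚ-δ i (𝟙S S)) (Σℚ-δ j (𝟙S S)) ⟩
      𝟙S S i - 𝟙S S j                                    ∎
      where open ≡-Reasoning
    uS≤1 : ∀ S → v · uS A S ≤ 1ℚ
    uS≤1 S = subst (_≤ 1ℚ) (sym (value S)) (𝟙-𝟙≤1 (lookup S i) (lookup S j))
    valid : ∀ {x} → HDel A x → v · x ≤ 1ℚ
    valid = HDel-·≤ v 1ℚ uS≤1
    on-face : ∀ {x} → Conv (Fij A i j) x → HDel A x × v · x ≡ 1ℚ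
    on-face x∈F = Conv-Vertex⊆HDel i (λ S (i∈S , _) → []=⇒lookup i∈S) x∈conv , Conv-Vertex-·≡ v 1ℚ between⇒1 x∈conv
      where
      x∈conv = proj₁ (Conv-Fij≐Conv-Vertex i j) x∈F
      between⇒1 : ∀ S → Between i j S → v · uS A S ≡ 1ℚ
      between⇒1 S (i∈S , j∉S) = trans (value S) (cong₂ (λ a c → 𝟙 a - 𝟙 c) ([]=⇒lookup i∈S) (∉⇒lookup≡false j∉S))
    face⊆ : ∀ {x} → HDel A x → v · x ≡ 1ℚ → Conv (Fij A i j) x
    face⊆ x∈P v·x≡1 = proj₂ (Conv-Fij≐Conv-Vertex i j) (HDel-face v 1ℚ uS≤1 between x∈P v·x≡1)
      where
      between : ∀ S → v · uS A S ≡ 1ℚ → Between i j S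
      between S v·uS≡1 = lookup⇒[]= i S (proj₁ i∈×j∉) , lookup≡false⇒∉ (proj₂ i∈×j∉)
        where i∈×j∉ = 𝟙-𝟙≡1 (lookup S i) (lookup S j) (trans (sym (value S)) v·uS≡1)

  module FacetNormal (F : Pred (Pt N) 0ℓ) (v : Pt N) (α : ℚ)
    (valid : ∀ {x} → HDel A x → v · x ≤ α)
    (F⇒face : ∀ {x} → F x → HDel A x × v · x ≡ α)
    (face⇒F : ∀ {x} → HDel A x → v · x ≡ α → F x)
    (F-dim : HasDim F m) where

    d : Fin N → ℚ
    d = rowValue v

    -- the maximum of v over the vertices u_S, attained exactly when S ∩ {d ≠ 0} = {d > 0}
    D : ℚ
    D = Σℚ (λ k → d k ⊔ 0ℚ)

    Tight : Subset N → Set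
    Tight S = ∀ k → 𝟙S S k * d k ≡ d k ⊔ 0ℚ

    uS≤D : ∀ S → v · uS A S ≤ D
    uS≤D S = subst (_≤ D) (sym (·-uS v S)) (Σℚ-mono-≤ (λ k → 𝟙*≤⊔0 (lookup S k) (d k)))

    Tight⇒uS≡D : ∀ S → Tight S → v · uS A S ≡ D
    Tight⇒uS≡D S tight = trans (·-uS v S) (Σℚ-cong tight)

    uS≡D⇒Tight : ∀ S → v · uS A S ≡ D → Tight S
    uS≡D⇒Tight S v·uS≡D k =
      sym (x∙y⁻¹≈ε⇒x≈y (d k ⊔ 0ℚ) (𝟙S S k * d k) (Σℚ-nonNeg≡0⇒≡0 (λ k → 0≤q-p (𝟙*≤⊔0 (lookup S k) (d k))) slack≡0 k))
      where
      slack≡0 : Σℚ (λ k → d k ⊔ 0ℚ - 𝟙S S k * d k) ≡ 0ℚ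
      slack≡0 = trans (Σℚ-- (λ k → d k ⊔ 0ℚ) (λ k → 𝟙S S k * d k))
                      (trans (cong (λ z → D - z) (trans (sym (·-uS v S)) v·uS≡D)) (+-inverseʳ D))

    p₀∈F : F (proj₁ (proj₁ F-dim) zero)
    p₀∈F = proj₁ (proj₂ (proj₁ F-dim)) zero

    α≤D : α ≤ D
    α≤D = subst (_≤ D) (proj₂ (F⇒face p₀∈F)) (HDel-·≤ v D uS≤D (proj₁ (F⇒face p₀∈F)))

    F⊆Conv-Tight : α ≡ D → F ⊆ Conv (Vertex Tight)
    F⊆Conv-Tight α≡D x∈F = HDel-face v D uS≤D uS≡D⇒Tight (proj₁ (F⇒face x∈F)) (trans (proj₂ (F⇒face x∈F)) α≡D)

    Conv-Tight⊆F : α ≡ D → ∀ i → (∀ S → Tight S → lookup S i ≡ true) → Conv (Vertex Tight) ⊆ F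
    Conv-Tight⊆F α≡D i i∈Tight x∈conv =
      face⇒F (Conv-Vertex⊆HDel i i∈Tight x∈conv) (trans (Conv-Vertex-·≡ v D Tight⇒uS≡D x∈conv) (sym α≡D))

    -- if v vanished on every b_k it would be constant on H_Del, which would then lie in F
    d≢0 : ∃[ k ] d k ≢ 0ℚ
    d≢0 = [ (λ found → found) , (λ none → ⊥-elim (proj₂ F-dim (hasAffIndep-⊆ {X = HDel A} (HDel⊆F none) (proj₁ HDel-dim)))) ]′
            (search (λ k → d k ≢ 0ℚ) (λ k → ¬? (d k ≟ 0ℚ)))
      where
      v·≡0 : (∀ k → ¬ d k ≢ 0ℚ) → ∀ {x} → HDel A x → v · x ≡ 0ℚ
      v·≡0 none x∈P = Conv-Vertex-·≡ v 0ℚ (λ S _ → trans (·-uS v S)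
        (Σℚ-zero (λ k → trans (cong (𝟙S S k *_) (decidable-stable (d k ≟ 0ℚ) (none k))) (*-zeroʳ (𝟙S S k))))) (HDel⊆Conv-Vertex x∈P)
      HDel⊆F : (∀ k → ¬ d k ≢ 0ℚ) → HDel A ⊆ F
      HDel⊆F none x∈P = face⇒F x∈P (trans (v·≡0 none x∈P) (sym α≡0))
        where α≡0 = trans (sym (proj₂ (F⇒face p₀∈F))) (v·≡0 none (proj₁ (F⇒face p₀∈F)))

    module _ {k₀ : Fin N} (dk₀≢0 : d k₀ ≢ 0ℚ) where

      i = proj₁ (argmax d)
      j = proj₁ (argmin d)

      0<di : 0ℚ < d i
      0<di = Σℚ≡0⇒max>0 (Σℚ-rowValue v) dk₀≢0 (proj₂ (argmax d))

      dj<0 : d j < 0ℚ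
      dj<0 = Σℚ≡0⇒min<0 (Σℚ-rowValue v) dk₀≢0 (proj₂ (argmin d))

      i≢j : i ≢ j
      i≢j i≡j = <-irrefl refl (<-trans (subst (λ k → d k < 0ℚ) (sym i≡j) dj<0) 0<di)

      Tight-fixes : ∀ S → Tight S → ∀ k → d k ≢ 0ℚ → lookup S k ≡ ⌊ 0ℚ <? d k ⌋
      Tight-fixes S tight k dk≢0 = 𝟙*≡⊔0⇒≡⌊0<?⌋ (lookup S k) (d k) dk≢0 (tight k)

      Tight⇒i∈ : ∀ S → Tight S → lookup S i ≡ true
      Tight⇒i∈ S tight = trans (Tight-fixes S tight i (λ di≡0 → <⇒≢ 0<di (sym di≡0))) (⌊⌋-true (0ℚ <? d i) 0<di)

      Tight⇒j∉ : ∀ S → Tight S → lookup S j ≡ false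
      Tight⇒j∉ S tight = trans (Tight-fixes S tight j (<⇒≢ dj<0)) (⌊⌋-false (0ℚ <? d j) (<-asym dj<0))

      positive : Subset N
      positive = tabulate (λ k → ⌊ 0ℚ <? d k ⌋)

      positive-Tight : Tight positive
      positive-Tight k = trans (cong (λ β → 𝟙 β * d k) (lookup∘tabulate (λ k → ⌊ 0ℚ <? d k ⌋) k)) (𝟙⌊0<?⌋*≡⊔0 (d k))

      α≡D : α ≡ D
      α≡D = ≤-antisym α≤D (subst (_≤ α) (Tight⇒uS≡D positive positive-Tight) (valid u⁺∈HDel))
        where
        u⁺∈HDel : HDel A (uS A positive)
        u⁺∈HDel = Conv-Vertex⊆HDel i Tight⇒i∈ (⊆Conv {X = Vertex Tight} (positive , positive-Tight , λ c → refl))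

      -- a third coordinate with d k ≠ 0 would be fixed on all of F as well, leaving F too few dimensions
      off-ij≡0 : ∀ k → k ≢ i → k ≢ j → d k ≡ 0ℚ
      off-ij≡0 k k≢i k≢j = decidable-stable (d k ≟ 0ℚ) λ dk≢0 →
        Conv-Vertex-upper q (cover dk≢0) (subst (HasAffIndep (Conv (Vertex Tight))) (sym (cong suc r+1≡m))
          (hasAffIndep-⊆ {X = F} (F⊆Conv-Tight α≡D) (proj₁ F-dim)))
        where
        three = cover-except₃ i≢j k≢i k≢j
        r+1≡m = proj₁ (proj₂ three)
        q = proj₁ (proj₂ (proj₂ three))
        cover : d k ≢ 0ℚ → ∀ x → (∃[ β ] ∀ S → Tight S → lookup S x ≡ β) ⊎ ∃[ t ] x ≡ q t
        cover dk≢0 x = [ (λ x≡i → inj₁ (fixed-at x≡i Tight⇒i∈)) ,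
                       [ (λ x≡j → inj₁ (fixed-at x≡j Tight⇒j∉)) ,
                       [ (λ x≡k → inj₁ (fixed-at x≡k (λ S tight → Tight-fixes S tight k dk≢0))) , inj₂ ]′ ]′ ]′
                       (proj₂ (proj₂ (proj₂ three)) x)

      Tight⇒Between : ∀ S → Tight S → Between i j S
      Tight⇒Between S tight = lookup⇒[]= i S (Tight⇒i∈ S tight) , lookup≡false⇒∉ (Tight⇒j∉ S tight)

      Between⇒Tight : ∀ S → Between i j S → Tight S
      Between⇒Tight S (i∈S , j∉S) k = by-cases (k Fin.≟ i) (k Fin.≟ j)
        where
        fixed : lookup S k ≡ ⌊ 0ℚ <? d k ⌋ → 𝟙S S k * d k ≡ d k ⊔ 0ℚ
        fixed eq = trans (cong (λ β → 𝟙 β * d k) eq) (𝟙⌊0<?⌋*≡⊔0 (d k))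
        by-cases : Dec (k ≡ i) → Dec (k ≡ j) → 𝟙S S k * d k ≡ d k ⊔ 0ℚ
        by-cases (yes k≡i) _         = fixed (trans (cong (lookup S) k≡i) (trans ([]=⇒lookup i∈S)
          (sym (trans (cong (λ y → ⌊ 0ℚ <? d y ⌋) k≡i) (⌊⌋-true (0ℚ <? d i) 0<di)))))
        by-cases (no _)    (yes k≡j) = fixed (trans (cong (lookup S) k≡j) (trans (∉⇒lookup≡false j∉S)
          (sym (trans (cong (λ y → ⌊ 0ℚ <? d y ⌋) k≡j) (⌊⌋-false (0ℚ <? d j) (<-asym dj<0))))))
        by-cases (no k≢i)  (no k≢j)  =
          trans (cong (𝟙S S k *_) dk≡0) (trans (*-zeroʳ (𝟙S S k)) (sym (trans (cong (_⊔ 0ℚ) dk≡0) (⊔-idem 0ℚ))))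
          where dk≡0 = off-ij≡0 k k≢i k≢j

      F≐Conv-Fij : F ≐ Conv (Fij A i j)
      F≐Conv-Fij = (λ x∈F → proj₂ (Conv-Fij≐Conv-Vertex i j) (Conv-Vertex-mono Tight⇒Between (F⊆Conv-Tight α≡D x∈F)))
                 , (λ x∈conv → Conv-Tight⊆F α≡D i Tight⇒i∈
                                 (Conv-Vertex-mono Between⇒Tight (proj₁ (Conv-Fij≐Conv-Vertex i j) x∈conv)))

    facet-is-Fij : ∃[ i ] ∃[ j ] (i ≢ j × F ≐ Conv (Fij A i j))
    facet-is-Fij = i (proj₂ d≢0) , j (proj₂ d≢0) , i≢j (proj₂ d≢0) , F≐Conv-Fij (proj₂ d≢0)

  facet⇒Fij : ∀ F → IsFacet (HDel A) F → ∃[ i ] ∃[ j ] (i ≢ j × F ≐ Conv (Fij A i j))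
  facet⇒Fij F ((v , α , valid , F⇒face , face⇒F) , k , HDel-dim′ , F-dim) =
    FacetNormal.facet-is-Fij F v α valid F⇒face face⇒F (subst (HasDim F) k≡m F-dim)
    where
    k≡m : k ≡ m
    k≡m = ℕP.suc-injective (hasDim-unique {S = HDel A} HDel-dim′ HDel-dim)

mainTheorem14 : (n : ℕ) → 1 ℕ.≤ n → (A : Adj n) → Symmetric A → Loopless A → Connected A →
    (F : Pred (Pt (suc n)) 0ℓ) →
    IsFacet (HDel A) F ⇔ (∃[ i ] ∃[ j ] (i ≢ j × F ≐ Conv (Fij A i j)))
mainTheorem14 (suc m) _ A A-sym A-loopless connected F =
  mk⇔ (facet⇒Fij F) (λ (i , j , i≢j , F≐Fij) → IsFacet-resp-≐ (≐-sym F≐Fij) (Fij-isFacet i≢j))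
  where open Facets A A-sym A-loopless connected
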